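{- For infinitely many $N$, there are $N\times N$ matrices $A,B$ with entries in $\{0,1\}$ such that: (1) every row of $A$ and every column of $B$ has a run-length encoding (and hence a grammar compression) of size $O(\log N)$, so the convenient compression of $(A,B)$ has size $O(N\log N)$; (2) $A$ and $B$ each have a strong compression of size $O(\log^2 N)$; (3) the product $C=AB$ (over the integers) has size $\Omega(N^2/\log^2 N)$ in any grammar compression: every row-wise compression of $C$, every column-wise compression of $C$, and every strong compression of $C$ has size $\Omega(N^2/\log^2 N)$.
   Context: A straight-line program (SLP), or grammar compression, of a string over an alphabet $\Sigma$ is a sequence of rules $S_1,\dots,S_n$, each either $S_i\to\sigma$ with $\sigma\in\Sigma$ or $S_i\to S_jS_k$ with $j,k<i$; it generates the string of its last rule, and its size is $n$. A run-length encoding replaces each maximal run of equal symbols by a (symbol, length) pair; its size is the number of runs. For an $N\times N$ matrix $M$: the convenient compression of a pair $(A,B)$ consists of a grammar compression of each row of $A$ and each column of $B$, its size being the total size; a row-wise (resp. column-wise) compression of $M$ consists of a grammar compression of each row (resp. column) of $M$, its size being the total size of these grammars; a strong compression of $M$ is a grammar compression of $M$ or of $M^T$ viewed as an $N^2$-dimensional vector (concatenation of rows), whichever is shorter. -}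

module Defs where

open import Data.Nat using (ℕ; zero; suc; _+_; _*_; _≤_; _<_)
import Data.Fin as Fin
open Fin using (Fin)
open import Data.List using (List; []; _∷_; _++_; length; concat; tabulate; replicate)
open import Data.Vec using (Vec; _∷ʳ_; last; lookup)
open import Data.Sum using (_⊎_; inj₁; inj₂)
open import Data.Product using (_×_; _,_; Σ)
open import Data.Unit using (⊤)
open import Relation.Binary.PropositionalEquality using (_≡_; _≢_)

-- A rule with index i (0-based): either a terminal σ, or S_i → S_j S_k with j,k < i.
Rule : Set → ℕ → Set
Rule Σ i = Σ ⊎ (Fin i × Fin i)

data Prog (Σ : Set) : ℕ → Set where
  []  : Prog Σ 0
  _▷_ : ∀ {n} → Prog Σ n → Rule Σ n → Prog Σ (suc n)

expansions : ∀ {Σ n} → Prog Σ n → Vec (List Σ) n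
expansions [] = Data.Vec.[]
expansions (p ▷ inj₁ σ) = expansions p ∷ʳ (σ ∷ [])
expansions (p ▷ inj₂ (j , k)) =
  let e = expansions p in e ∷ʳ (lookup e j ++ lookup e k)

record GrammarCompression (Σ : Set) (w : List Σ) : Set where
  field
    k         : ℕ
    prog      : Prog Σ (suc k)
    generates : last (expansions prog) ≡ w

gcSize : ∀ {Σ w} → GrammarCompression Σ w → ℕ
gcSize g = suc (GrammarCompression.k g)

decode : ∀ {Σ : Set} → List (Σ × ℕ) → List Σ
decode [] = []
decode ((σ , ℓ) ∷ rs) = replicate ℓ σ ++ decode rs

-- Well-formedness: every run length is positive and adjacent runs have different
-- symbols (so the runs are maximal).
ValidRLE : ∀ {Σ : Set} → List (Σ × ℕ) → Set
ValidRLE [] = ⊤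
ValidRLE ((σ , ℓ) ∷ []) = 1 ≤ ℓ
ValidRLE ((σ , ℓ) ∷ (τ , m) ∷ rs) = 1 ≤ ℓ × σ ≢ τ × ValidRLE ((τ , m) ∷ rs)

record RLE (Σ : Set) (w : List Σ) : Set where
  field
    runs    : List (Σ × ℕ)
    valid   : ValidRLE runs
    decodes : decode runs ≡ w

rleSize : ∀ {Σ w} → RLE Σ w → ℕ
rleSize r = length (RLE.runs r)

Matrix : ℕ → Set
Matrix N = Fin N → Fin N → ℕ

row : ∀ {N} → Matrix N → Fin N → List ℕ
row M i = tabulate (M i)

col : ∀ {N} → Matrix N → Fin N → List ℕ
col M j = tabulate (λ i → M i j)

transpose : ∀ {N} → Matrix N → Matrix N
transpose M i j = M j i

flatten : ∀ {N} → Matrix N → List ℕ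
flatten M = concat (tabulate (row M))

IsZeroOne : ∀ {N} → Matrix N → Set
IsZeroOne M = ∀ i j → M i j ≤ 1

sumFin : ∀ {n} → (Fin n → ℕ) → ℕ
sumFin {zero} f = 0
sumFin {suc n} f = f Fin.zero + sumFin (λ i → f (Fin.suc i))

-- Integer (here: natural-number) matrix product.
_⊗_ : ∀ {N} → Matrix N → Matrix N → Matrix N
(A ⊗ B) i j = sumFin (λ k → A i k * B k j)

record ConvenientCompression {N} (A B : Matrix N) : Set where
  field
    rowsA : (i : Fin N) → GrammarCompression ℕ (row A i)
    colsB : (j : Fin N) → GrammarCompression ℕ (col B j)

convSize : ∀ {N} {A B : Matrix N} → ConvenientCompression A B → ℕ
convSize c = sumFin (λ i → gcSize (ConvenientCompression.rowsA c i))
           + sumFin (λ j → gcSize (ConvenientCompression.colsB c j))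

RowWiseCompression : ∀ {N} → Matrix N → Set
RowWiseCompression {N} M = (i : Fin N) → GrammarCompression ℕ (row M i)

rowWiseSize : ∀ {N} (M : Matrix N) → RowWiseCompression M → ℕ
rowWiseSize M c = sumFin (λ i → gcSize (c i))

ColumnWiseCompression : ∀ {N} → Matrix N → Set
ColumnWiseCompression {N} M = (j : Fin N) → GrammarCompression ℕ (col M j)

columnWiseSize : ∀ {N} (M : Matrix N) → ColumnWiseCompression M → ℕ
columnWiseSize M c = sumFin (λ j → gcSize (c j))

-- A strong compression: a grammar compression of M or of Mᵀ viewed as the
-- N²-dimensional vector of concatenated rows.  (The paper's "whichever is
-- shorter" only fixes which one is meant by *the* strong compression; bounds
-- over all strong compressions are stated over both alternatives.)
StrongCompression : ∀ {N} → Matrix N → Set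
StrongCompression M = GrammarCompression ℕ (flatten M) ⊎ GrammarCompression ℕ (flatten (transpose M))

strongSize : ∀ {N} (M : Matrix N) → StrongCompression M → ℕ
strongSize M (inj₁ g) = gcSize g
strongSize M (inj₂ g) = gcSize g

-- Take N = 2^(L+1). Row x of A is 2^L copies of the last bit of x followed by the code of x, in which
-- bit b of x is repeated 2^b times and a 0 is appended; column y of B is the code of y followed by 2^L
-- copies of [y even]. The code of x sums to x when x < 2^L, so there C x y = (x mod 2) y + x [y even]:
-- for all a, b < N/4, row 2a+1 of C contains the adjacent pair (2b+2a+1, 2b+1) and column 2b contains
-- (2a, 2b+2a+1). Two adjacent letters of the word generated by a straight-line program meet at the seam
-- of one of its binary rules, so a word with k distinct adjacent pairs needs at least k rules: N/4 for
-- each such row or column of C, and N²/16 for C or Cᵀ flattened.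
-- Conversely, rows of A and columns of B are O(log N) runs of power-of-two lengths, all cut from two
-- shared doubling chains, while the columns of A and rows of B are periodic bit patterns that group
-- into O(log N) blocks of O(log N) rules each.

module Submission where

open import Defs

open import Data.Fin using (Fin; toℕ)
import Data.Fin as Fin
open import Data.Fin.Properties using (injective⇒≤; combine-remQuot; toℕ-injective; toℕ<n)
open import Data.List
  using (List; []; _∷_; _++_; [_]; length; head; last; concat; replicate; tabulate; applyUpTo; zipWith)
import Data.List as List
open import Data.List.Membership.Propositional using (_∈_)
open import Data.List.Properties
  using (length-++; length-replicate; length-map; length-applyUpTo; concat-++; ++-identityʳ; ++-assoc; map-++;
         tabulate-cong; applyUpTo-∷ʳ; map-applyUpTo)
open import Data.List.Relation.Unary.All using (All; []; _∷_)
import Data.List.Relation.Unary.All as All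
import Data.List.Relation.Unary.All.Properties as All
open import Data.List.Relation.Unary.Any using (here; there; index)
open import Data.List.Relation.Unary.Any.Properties using (lookup-index)
open import Data.Maybe using (Maybe; just)
open import Data.Maybe.Properties using (just-injective)
open import Data.Nat using (ℕ; zero; suc; _+_; _*_; _∸_; _^_; _≤_; _<_; z≤n; s≤s; s≤s⁻¹; ⌊_/2⌋)
open import Data.Nat.ListAction using (sum)
open import Data.Nat.ListAction.Properties using (sum-++)
open import Data.Nat.Logarithm using (⌊log₂_⌋; ⌊log₂[2^n]⌋≡n)
open import Data.Nat.Properties
open import Data.Nat.Tactic.RingSolver using (solve-∀)
open import Data.Product using (Σ; ∃; _×_; _,_; proj₁; proj₂; map₂; uncurry)
import Data.Product as Product
open import Data.Sum using (_⊎_; inj₁; inj₂)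
open import Data.Unit using (tt)
open import Data.Vec as Vec using (Vec)
open import Data.Vec.Properties using (last-∷ʳ)
open import Function using (_∘_; const)
open import Function.Definitions using (Injective)
open import Relation.Binary.Definitions using (DecidableEquality)
open import Relation.Binary.PropositionalEquality hiding ([_])
open import Relation.Nullary using (yes; no)
open ≡-Reasoning

2^-suc : ∀ n → 2 ^ suc n ≡ 2 ^ n + 2 ^ n
2^-suc n = cong (2 ^ n +_) (+-identityʳ (2 ^ n))

private variable
  A : Set

tabulate-toℕ : ∀ n (f : ℕ → A) → tabulate {n = n} (f ∘ toℕ) ≡ applyUpTo f n
tabulate-toℕ zero    f = refl
tabulate-toℕ (suc n) f = cong (f 0 ∷_) (tabulate-toℕ n (f ∘ suc))

tabulate-toℕ≗ : ∀ n {g : Fin n → A} (f : ℕ → A) → (∀ i → g i ≡ f (toℕ i)) → tabulate g ≡ applyUpTo f n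
tabulate-toℕ≗ n f g≗f = trans (tabulate-cong g≗f) (tabulate-toℕ n f)

applyUpTo-cong : ∀ n {f g : ℕ → A} → (∀ i → i < n → f i ≡ g i) → applyUpTo f n ≡ applyUpTo g n
applyUpTo-cong zero    f≗g = refl
applyUpTo-cong (suc n) f≗g = cong₂ _∷_ (f≗g 0 (s≤s z≤n)) (applyUpTo-cong n (λ i i<n → f≗g (suc i) (s≤s i<n)))

applyUpTo-++ : ∀ m n (f : ℕ → A) → applyUpTo f (m + n) ≡ applyUpTo f m ++ applyUpTo (f ∘ (m +_)) n
applyUpTo-++ zero    n f = refl
applyUpTo-++ (suc m) n f = cong (f 0 ∷_) (applyUpTo-++ m n (f ∘ suc))

applyUpTo-const : ∀ n (x : A) → applyUpTo (const x) n ≡ replicate n x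
applyUpTo-const zero    x = refl
applyUpTo-const (suc n) x = cong (x ∷_) (applyUpTo-const n x)

length-applyUpTo-++ : ∀ {A : Set} n (f : ℕ → A) (xs : List A) → length (applyUpTo f n ++ xs) ≡ n + length xs
length-applyUpTo-++ n f xs = trans (length-++ (applyUpTo f n)) (cong (_+ length xs) (length-applyUpTo f n))

concat-applyUpTo-suc : ∀ n (f : ℕ → List A) → concat (applyUpTo f (suc n)) ≡ concat (applyUpTo f n) ++ f n
concat-applyUpTo-suc n f = begin
  concat (applyUpTo f (suc n))              ≡⟨ cong concat (applyUpTo-∷ʳ f n) ⟨
  concat (applyUpTo f n ++ [ f n ])         ≡⟨ concat-++ (applyUpTo f n) [ f n ] ⟨
  concat (applyUpTo f n) ++ (f n ++ [])     ≡⟨ cong (concat (applyUpTo f n) ++_) (++-identityʳ (f n)) ⟩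
  concat (applyUpTo f n) ++ f n             ∎

concat-applyUpTo-halves : ∀ L (f : ℕ → List A) →
  concat (applyUpTo f (2 ^ suc L)) ≡ concat (applyUpTo f (2 ^ L)) ++ concat (applyUpTo (f ∘ (2 ^ L +_)) (2 ^ L))
concat-applyUpTo-halves L f = begin
  concat (applyUpTo f (2 ^ suc L))                                             ≡⟨ cong (concat ∘ applyUpTo f) (2^-suc L) ⟩
  concat (applyUpTo f (2 ^ L + 2 ^ L))                                         ≡⟨ cong concat (applyUpTo-++ (2 ^ L) (2 ^ L) f) ⟩
  concat (applyUpTo f (2 ^ L) ++ applyUpTo (f ∘ (2 ^ L +_)) (2 ^ L))           ≡⟨ concat-++ (applyUpTo f (2 ^ L)) _ ⟨
  concat (applyUpTo f (2 ^ L)) ++ concat (applyUpTo (f ∘ (2 ^ L +_)) (2 ^ L))  ∎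

replicate-+ : ∀ m n (x : A) → replicate (m + n) x ≡ replicate m x ++ replicate n x
replicate-+ zero    n x = refl
replicate-+ (suc m) n x = cong (x ∷_) (replicate-+ m n x)

sum-replicate : ∀ n v → sum (replicate n v) ≡ n * v
sum-replicate zero    v = refl
sum-replicate (suc n) v = cong (v +_) (sum-replicate n v)

doubling : ℕ → List A → List A
doubling zero    u = u
doubling (suc d) u = doubling d u ++ doubling d u

doubling-[_] : ∀ d (x : A) → doubling d [ x ] ≡ replicate (2 ^ d) x
doubling-[ zero  ] x = refl
doubling-[ suc d ] x = begin
  doubling d [ x ] ++ doubling d [ x ]          ≡⟨ cong₂ _++_ (doubling-[ d ] x) (doubling-[ d ] x) ⟩
  replicate (2 ^ d) x ++ replicate (2 ^ d) x    ≡⟨ replicate-+ (2 ^ d) (2 ^ d) x ⟨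
  replicate (2 ^ d + 2 ^ d) x                   ≡⟨ cong (λ n → replicate n x) (2^-suc d) ⟨
  replicate (2 ^ suc d) x                       ∎

concat-replicate-2^ : ∀ d (u : List A) → concat (replicate (2 ^ d) u) ≡ doubling d u
concat-replicate-2^ zero    u = ++-identityʳ u
concat-replicate-2^ (suc d) u = begin
  concat (replicate (2 ^ suc d) u)                            ≡⟨ cong (λ n → concat (replicate n u)) (2^-suc d) ⟩
  concat (replicate (2 ^ d + 2 ^ d) u)                        ≡⟨ cong concat (replicate-+ (2 ^ d) (2 ^ d) u) ⟩
  concat (replicate (2 ^ d) u ++ replicate (2 ^ d) u)         ≡⟨ concat-++ (replicate (2 ^ d) u) _ ⟨
  concat (replicate (2 ^ d) u) ++ concat (replicate (2 ^ d) u) ≡⟨ cong₂ _++_ (concat-replicate-2^ d u) (concat-replicate-2^ d u) ⟩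
  doubling d u ++ doubling d u                                ∎

concat-applyUpTo-2^ : ∀ d {f : ℕ → List A} {u} → (∀ i → i < 2 ^ d → f i ≡ u) →
                      concat (applyUpTo f (2 ^ d)) ≡ doubling d u
concat-applyUpTo-2^ d {f} {u} f≗u = begin
  concat (applyUpTo f (2 ^ d))           ≡⟨ cong concat (applyUpTo-cong (2 ^ d) f≗u) ⟩
  concat (applyUpTo (const u) (2 ^ d))   ≡⟨ cong concat (applyUpTo-const (2 ^ d) u) ⟩
  concat (replicate (2 ^ d) u)           ≡⟨ concat-replicate-2^ d u ⟩
  doubling d u                           ∎

Periodic : (ℕ → A) → ℕ → Set
Periodic f P = ∀ i → f (P + i) ≡ f i

periodic-2^ : ∀ {f : ℕ → A} {e} → Periodic f (2 ^ e) → ∀ d → Periodic f (2 ^ (d + e))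
periodic-2^ per zero = per
periodic-2^ {f = f} {e = e} per (suc d) i = begin
  f (2 ^ suc (d + e) + i)          ≡⟨ cong (λ n → f (n + i)) (2^-suc (d + e)) ⟩
  f (P + P + i)                    ≡⟨ cong f (+-assoc P P i) ⟩
  f (P + (P + i))                  ≡⟨ periodic-2^ per d (P + i) ⟩
  f (P + i)                        ≡⟨ periodic-2^ per d i ⟩
  f i                              ∎
  where P = 2 ^ (d + e)

applyUpTo-periodic : ∀ {f : ℕ → A} {e} → Periodic f (2 ^ e) → ∀ d →
                     applyUpTo f (2 ^ (d + e)) ≡ doubling d (applyUpTo f (2 ^ e))
applyUpTo-periodic per zero = refl
applyUpTo-periodic {f = f} {e = e} per (suc d) = begin
  applyUpTo f (2 ^ suc (d + e))                ≡⟨ cong (applyUpTo f) (2^-suc (d + e)) ⟩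
  applyUpTo f (P + P)                          ≡⟨ applyUpTo-++ P P f ⟩
  applyUpTo f P ++ applyUpTo (f ∘ (P +_)) P    ≡⟨ cong (applyUpTo f P ++_) (applyUpTo-cong P (λ i _ → periodic-2^ per d i)) ⟩
  applyUpTo f P ++ applyUpTo f P               ≡⟨ cong₂ _++_ (applyUpTo-periodic per d) (applyUpTo-periodic per d) ⟩
  doubling (suc d) (applyUpTo f (2 ^ e))       ∎
  where P = 2 ^ (d + e)

at : List ℕ → ℕ → ℕ
at []       k       = 0
at (x ∷ xs) zero    = x
at (x ∷ xs) (suc k) = at xs k

at-++ˡ : ∀ xs ys {k} → k < length xs → at (xs ++ ys) k ≡ at xs k
at-++ˡ (x ∷ xs) ys {zero}  _         = refl
at-++ˡ (x ∷ xs) ys {suc k} (s≤s k<) = at-++ˡ xs ys k<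

at-++ʳ : ∀ xs ys k → at (xs ++ ys) (length xs + k) ≡ at ys k
at-++ʳ []       ys k = refl
at-++ʳ (x ∷ xs) ys k = at-++ʳ xs ys k

at-replicate : ∀ n x {k} → k < n → at (replicate n x) k ≡ x
at-replicate (suc n) x {zero}  _         = refl
at-replicate (suc n) x {suc k} (s≤s k<) = at-replicate n x k<

at-≤1 : ∀ {xs} → All (_≤ 1) xs → ∀ k → at xs k ≤ 1
at-≤1 []         k       = z≤n
at-≤1 (x≤ ∷ _)   zero    = x≤
at-≤1 (_ ∷ xs≤)  (suc k) = at-≤1 xs≤ k

tabulate-at : ∀ {n} xs → length xs ≡ n → tabulate {n = n} (at xs ∘ toℕ) ≡ xs
tabulate-at []       refl = refl
tabulate-at (x ∷ xs) refl = cong (x ∷_) (tabulate-at xs refl)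

dot : List ℕ → List ℕ → ℕ
dot u v = sum (zipWith _*_ u v)

dot-++ : ∀ u v {u′ v′} → length u ≡ length v → dot (u ++ u′) (v ++ v′) ≡ dot u v + dot u′ v′
dot-++ []       []       _   = refl
dot-++ (x ∷ u) (y ∷ v) eq = trans (cong (x * y +_) (dot-++ u v (suc-injective eq))) (sym (+-assoc (x * y) _ _))

dot-replicateˡ : ∀ a v {n} → length v ≡ n → dot (replicate n a) v ≡ a * sum v
dot-replicateˡ a []      refl = sym (*-zeroʳ a)
dot-replicateˡ a (y ∷ v) refl = trans (cong (a * y +_) (dot-replicateˡ a v refl)) (sym (*-distribˡ-+ a y (sum v)))

dot-replicateʳ : ∀ u b {n} → length u ≡ n → dot u (replicate n b) ≡ sum u * b
dot-replicateʳ []      b refl = refl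
dot-replicateʳ (x ∷ u) b refl = trans (cong (x * b +_) (dot-replicateʳ u b refl)) (sym (*-distribʳ-+ b x (sum u)))

sumFin-dot : ∀ {n} (f g : Fin n → ℕ) → sumFin (λ k → f k * g k) ≡ dot (tabulate f) (tabulate g)
sumFin-dot {zero}  f g = refl
sumFin-dot {suc n} f g = cong (f Fin.zero * g Fin.zero +_) (sumFin-dot (f ∘ Fin.suc) (g ∘ Fin.suc))

⊗-dot : ∀ {N} (A B : Matrix N) i j → (A ⊗ B) i j ≡ dot (row A i) (col B j)
⊗-dot A B i j = sumFin-dot (A i) (λ k → B k j)

sumFin-≤ : ∀ {n K} (f : Fin n → ℕ) → (∀ i → f i ≤ K) → sumFin f ≤ n * K
sumFin-≤ {zero}  f f≤ = z≤n
sumFin-≤ {suc n} f f≤ = +-mono-≤ (f≤ Fin.zero) (sumFin-≤ (f ∘ Fin.suc) (f≤ ∘ Fin.suc))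

injection⇒≤length : ∀ {M} {ys : List A} (f : Fin M → A) → Injective _≡_ _≡_ f → (∀ a → f a ∈ ys) → M ≤ length ys
injection⇒≤length {ys = ys} f f-inj f∈ys = injective⇒≤ λ {a} {b} eq → f-inj (begin
  f a                                    ≡⟨ lookup-index (f∈ys a) ⟩
  List.lookup ys (index (f∈ys a))        ≡⟨ cong (List.lookup ys) eq ⟩
  List.lookup ys (index (f∈ys b))        ≡⟨ lookup-index (f∈ys b) ⟨
  f b                                    ∎)

lsb : ℕ → ℕ
lsb zero          = 0
lsb (suc zero)    = 1
lsb (suc (suc n)) = lsb n

bit : ℕ → ℕ → ℕ
bit zero    x = lsb x
bit (suc b) x = bit b ⌊ x /2⌋

lsb≤1 : ∀ x → lsb x ≤ 1
lsb≤1 zero          = z≤n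
lsb≤1 (suc zero)    = s≤s z≤n
lsb≤1 (suc (suc x)) = lsb≤1 x

bit≤1 : ∀ b x → bit b x ≤ 1
bit≤1 zero    x = lsb≤1 x
bit≤1 (suc b) x = bit≤1 b ⌊ x /2⌋

lsb[2*m+n]≡lsb[n] : ∀ m n → lsb (2 * m + n) ≡ lsb n
lsb[2*m+n]≡lsb[n] zero    n = refl
lsb[2*m+n]≡lsb[n] (suc m) n = trans (cong (λ k → lsb (k + n)) (*-suc 2 m)) (lsb[2*m+n]≡lsb[n] m n)

lsb[2*n]≡0 : ∀ n → lsb (2 * n) ≡ 0
lsb[2*n]≡0 n = trans (cong lsb (sym (+-identityʳ (2 * n)))) (lsb[2*m+n]≡lsb[n] n 0)

lsb[1+2*n]≡1 : ∀ n → lsb (1 + 2 * n) ≡ 1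
lsb[1+2*n]≡1 n = trans (cong lsb (+-comm 1 (2 * n))) (lsb[2*m+n]≡lsb[n] n 1)

n≡lsb[n]+2*⌊n/2⌋ : ∀ n → n ≡ lsb n + 2 * ⌊ n /2⌋
n≡lsb[n]+2*⌊n/2⌋ zero          = refl
n≡lsb[n]+2*⌊n/2⌋ (suc zero)    = refl
n≡lsb[n]+2*⌊n/2⌋ (suc (suc n))
  rewrite *-suc 2 ⌊ n /2⌋ | +-suc (lsb n) (suc (2 * ⌊ n /2⌋)) | +-suc (lsb n) (2 * ⌊ n /2⌋)
  = cong (2 +_) (n≡lsb[n]+2*⌊n/2⌋ n)

⌊2*m+n/2⌋≡m+⌊n/2⌋ : ∀ m n → ⌊ 2 * m + n /2⌋ ≡ m + ⌊ n /2⌋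
⌊2*m+n/2⌋≡m+⌊n/2⌋ zero    n = refl
⌊2*m+n/2⌋≡m+⌊n/2⌋ (suc m) n =
  trans (cong (λ k → ⌊ k + n /2⌋) (*-suc 2 m)) (cong suc (⌊2*m+n/2⌋≡m+⌊n/2⌋ m n))

⌊n/2⌋<m : ∀ {m} n → n < 2 * m → ⌊ n /2⌋ < m
⌊n/2⌋<m {suc m} zero          _  = s≤s z≤n
⌊n/2⌋<m {suc m} (suc zero)    _  = s≤s z≤n
⌊n/2⌋<m {suc m} (suc (suc n)) lt rewrite *-suc 2 m = s≤s (⌊n/2⌋<m n (≤-pred (≤-pred lt)))

n<2^n : ∀ n → n < 2 ^ n
n<2^n zero    = s≤s z≤n
n<2^n (suc n) = subst (_≤ 2 ^ suc n) (+-comm (suc n) 1) (+-mono-≤ (n<2^n n) (≤-trans (m^n>0 2 n) (m≤m+n (2 ^ n) 0)))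

bit-low : ∀ b {x} → x < 2 ^ b → bit b x ≡ 0
bit-low zero    {zero}  _         = refl
bit-low zero    {suc x} (s≤s ())
bit-low (suc b) {x}    lt = bit-low b (⌊n/2⌋<m x lt)

bit-high : ∀ b {x} → x < 2 ^ b → bit b (2 ^ b + x) ≡ 1
bit-high zero    {zero}  _         = refl
bit-high zero    {suc x} (s≤s ())
bit-high (suc b) {x}    lt rewrite ⌊2*m+n/2⌋≡m+⌊n/2⌋ (2 ^ b) x = bit-high b (⌊n/2⌋<m x lt)

bit-periodic : ∀ b → Periodic (bit b) (2 ^ suc b)
bit-periodic zero    i = refl
bit-periodic (suc b) i rewrite ⌊2*m+n/2⌋≡m+⌊n/2⌋ (2 ^ suc b) i = bit-periodic b ⌊ i /2⌋

bit-2^+ : ∀ {b L} r → b < L → bit b (2 ^ L + r) ≡ bit b r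
bit-2^+ {b} {L} r b<L =
  trans (cong (λ e → bit b (2 ^ e + r)) (sym (m∸n+n≡m b<L))) (periodic-2^ (bit-periodic b) (L ∸ suc b) r)

applyUpTo-bit : ∀ d b → applyUpTo (bit b) (2 ^ (d + suc b)) ≡ doubling d (doubling b [ 0 ] ++ doubling b [ 1 ])
applyUpTo-bit d b = trans (applyUpTo-periodic (bit-periodic b) d) (cong (doubling d) period)
  where
  period : applyUpTo (bit b) (2 ^ suc b) ≡ doubling b [ 0 ] ++ doubling b [ 1 ]
  period = begin
    applyUpTo (bit b) (2 ^ suc b)
      ≡⟨ cong (applyUpTo (bit b)) (2^-suc b) ⟩
    applyUpTo (bit b) (2 ^ b + 2 ^ b)
      ≡⟨ applyUpTo-++ (2 ^ b) (2 ^ b) (bit b) ⟩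
    applyUpTo (bit b) (2 ^ b) ++ applyUpTo (bit b ∘ (2 ^ b +_)) (2 ^ b)
      ≡⟨ cong₂ _++_ (applyUpTo-cong (2 ^ b) (λ _ i< → bit-low b i<)) (applyUpTo-cong (2 ^ b) (λ _ i< → bit-high b i<)) ⟩
    applyUpTo (const 0) (2 ^ b) ++ applyUpTo (const 1) (2 ^ b)
      ≡⟨ cong₂ _++_ (applyUpTo-const (2 ^ b) 0) (applyUpTo-const (2 ^ b) 1) ⟩
    replicate (2 ^ b) 0 ++ replicate (2 ^ b) 1
      ≡⟨ cong₂ _++_ (doubling-[ b ] 0) (doubling-[ b ] 1) ⟨
    doubling b [ 0 ] ++ doubling b [ 1 ]
      ∎

bitPattern : ℕ → ℕ → List ℕ
bitPattern L b = doubling (L ∸ b) (doubling b [ 0 ] ++ doubling b [ 1 ])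

applyUpTo-bit-2^[1+L] : ∀ {b L} → b ≤ L → applyUpTo (bit b) (2 ^ suc L) ≡ bitPattern L b
applyUpTo-bit-2^[1+L] {b} {L} b≤L = trans (cong (applyUpTo (bit b) ∘ (2 ^_)) (sym exponent)) (applyUpTo-bit (L ∸ b) b)
  where
  exponent : L ∸ b + suc b ≡ suc L
  exponent = trans (+-suc (L ∸ b) b) (cong suc (m∸n+n≡m b≤L))

applyUpTo-lsb∘suc : ∀ L → applyUpTo (lsb ∘ suc) (2 ^ suc L) ≡ doubling L (1 ∷ 0 ∷ [])
applyUpTo-lsb∘suc L = trans (cong (applyUpTo (lsb ∘ suc) ∘ (2 ^_)) (+-comm 1 L)) (applyUpTo-periodic {e = 1} (λ _ → refl) L)

sumFin-lsb : ∀ {h} r m {N} (f : Fin N → ℕ) → r ≤ 1 → 2 * m ≤ N →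
             (∀ i → toℕ i < 2 * m → lsb (toℕ i) ≡ r → h ≤ f i) → m * h ≤ sumFin f
sumFin-lsb r zero f _ _ _ = z≤n
sumFin-lsb {h} r (suc m) {N} f r≤1 2m≤N f≥h =
  go f (subst (_≤ N) (*-suc 2 m) 2m≤N) (λ i i< → f≥h i (subst (toℕ i <_) (sym (*-suc 2 m)) i<))
  where
  first-two : ∀ {r N} (f : Fin (2 + N) → ℕ) → r ≤ 1 → (∀ i → toℕ i < 2 → lsb (toℕ i) ≡ r → h ≤ f i) →
              h ≤ f Fin.zero + f (Fin.suc Fin.zero)
  first-two f z≤n       f≥h = ≤-trans (f≥h Fin.zero (s≤s z≤n) refl) (m≤m+n _ _)
  first-two f (s≤s z≤n) f≥h = ≤-trans (f≥h (Fin.suc Fin.zero) (s≤s (s≤s z≤n)) refl) (m≤n+m _ _)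
  go : ∀ {N} (f : Fin N → ℕ) → 2 + 2 * m ≤ N → (∀ i → toℕ i < 2 + 2 * m → lsb (toℕ i) ≡ r → h ≤ f i) →
       suc m * h ≤ sumFin f
  go {suc (suc N)} f (s≤s (s≤s 2m≤N)) f≥h = ≤-trans (+-mono-≤ first rest) (≤-reflexive (+-assoc (f Fin.zero) _ _))
    where
    first = first-two f r≤1 (λ i i< → f≥h i (≤-trans i< (m≤m+n 2 (2 * m))))
    rest = sumFin-lsb r m (λ i → f (Fin.suc (Fin.suc i))) r≤1 2m≤N (λ i i< → f≥h (Fin.suc (Fin.suc i)) (s≤s (s≤s i<)))

-- The binary code of a number

bitRuns : ℕ → ℕ → List ℕ
bitRuns L x = concat (applyUpTo (λ b → replicate (2 ^ b) (bit b x)) L)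

bitRuns-suc : ∀ L x → bitRuns (suc L) x ≡ bitRuns L x ++ replicate (2 ^ L) (bit L x)
bitRuns-suc L x = concat-applyUpTo-suc L (λ b → replicate (2 ^ b) (bit b x))

bitRuns-+ : ∀ m n x → bitRuns (m + n) x ≡ bitRuns m x ++ concat (applyUpTo (λ c → replicate (2 ^ (m + c)) (bit (m + c) x)) n)
bitRuns-+ m n x = trans (cong concat (applyUpTo-++ m n _)) (sym (concat-++ (applyUpTo _ m) _))

blockStart : ℕ → ℕ
blockStart zero    = 0
blockStart (suc b) = blockStart b + 2 ^ b

length-bitRuns : ∀ L x → length (bitRuns L x) ≡ blockStart L
length-bitRuns zero    x = refl
length-bitRuns (suc L) x = begin
  length (bitRuns (suc L) x)                                       ≡⟨ cong length (bitRuns-suc L x) ⟩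
  length (bitRuns L x ++ replicate (2 ^ L) (bit L x))              ≡⟨ length-++ (bitRuns L x) ⟩
  length (bitRuns L x) + length (replicate (2 ^ L) (bit L x))      ≡⟨ cong₂ _+_ (length-bitRuns L x) (length-replicate (2 ^ L)) ⟩
  blockStart L + 2 ^ L                                                 ∎

1+blockStart : ∀ L → 1 + blockStart L ≡ 2 ^ L
1+blockStart zero    = refl
1+blockStart (suc L) = trans (cong (_+ 2 ^ L) (1+blockStart L)) (sym (2^-suc L))

bitRuns-periodic : ∀ L r → bitRuns L (2 ^ L + r) ≡ bitRuns L r
bitRuns-periodic L r = cong concat (applyUpTo-cong L (λ b b<L → cong (replicate (2 ^ b)) (bit-2^+ r b<L)))

sum-bitRuns-suc : ∀ L x → sum (bitRuns (suc L) x) ≡ sum (bitRuns L x) + 2 ^ L * bit L x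
sum-bitRuns-suc L x = begin
  sum (bitRuns (suc L) x)                                          ≡⟨ cong sum (bitRuns-suc L x) ⟩
  sum (bitRuns L x ++ replicate (2 ^ L) (bit L x))                 ≡⟨ sum-++ (bitRuns L x) _ ⟩
  sum (bitRuns L x) + sum (replicate (2 ^ L) (bit L x))            ≡⟨ cong (sum (bitRuns L x) +_) (sum-replicate (2 ^ L) (bit L x)) ⟩
  sum (bitRuns L x) + 2 ^ L * bit L x                              ∎

sum-bitRuns : ∀ L {x} → x < 2 ^ L → sum (bitRuns L x) ≡ x
sum-bitRuns zero    {zero}  _        = refl
sum-bitRuns zero    {suc x} (s≤s ())
sum-bitRuns (suc L) {x}     x<       with x <? 2 ^ L
... | yes x<2^L = begin
  sum (bitRuns (suc L) x)                           ≡⟨ sum-bitRuns-suc L x ⟩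
  sum (bitRuns L x) + 2 ^ L * bit L x               ≡⟨ cong₂ _+_ (sum-bitRuns L x<2^L) (cong (2 ^ L *_) (bit-low L x<2^L)) ⟩
  x + 2 ^ L * 0                                     ≡⟨ cong (x +_) (*-zeroʳ (2 ^ L)) ⟩
  x + 0                                             ≡⟨ +-identityʳ x ⟩
  x                                                 ∎
... | no x≮2^L = begin
  sum (bitRuns (suc L) x)                           ≡⟨ cong (sum ∘ bitRuns (suc L)) 2^L+r≡x ⟨
  sum (bitRuns (suc L) (2 ^ L + r))                 ≡⟨ sum-bitRuns-suc L (2 ^ L + r) ⟩
  sum (bitRuns L (2 ^ L + r)) + 2 ^ L * bit L (2 ^ L + r)
    ≡⟨ cong₂ _+_ (cong sum (bitRuns-periodic L r)) (cong (2 ^ L *_) (bit-high L r<2^L)) ⟩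
  sum (bitRuns L r) + 2 ^ L * 1                     ≡⟨ cong₂ _+_ (sum-bitRuns L r<2^L) (*-identityʳ (2 ^ L)) ⟩
  r + 2 ^ L                                         ≡⟨ +-comm r (2 ^ L) ⟩
  2 ^ L + r                                         ≡⟨ 2^L+r≡x ⟩
  x                                                 ∎
  where
  r = x ∸ 2 ^ L
  2^L+r≡x : 2 ^ L + r ≡ x
  2^L+r≡x = m+[n∸m]≡n (≮⇒≥ x≮2^L)
  r<2^L : r < 2 ^ L
  r<2^L = +-cancelˡ-< (2 ^ L) r (2 ^ L) (subst₂ _<_ (sym 2^L+r≡x) (2^-suc L) x<)

code : ℕ → ℕ → List ℕ
code L x = bitRuns L x ++ [ 0 ]

length-code : ∀ L x → length (code L x) ≡ 2 ^ L
length-code L x = begin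
  length (bitRuns L x ++ [ 0 ])   ≡⟨ length-++ (bitRuns L x) ⟩
  length (bitRuns L x) + 1        ≡⟨ cong (_+ 1) (length-bitRuns L x) ⟩
  blockStart L + 1                    ≡⟨ +-comm (blockStart L) 1 ⟩
  1 + blockStart L                    ≡⟨ 1+blockStart L ⟩
  2 ^ L                           ∎

sum-code : ∀ L {x} → x < 2 ^ L → sum (code L x) ≡ x
sum-code L {x} x< = trans (sum-++ (bitRuns L x) [ 0 ]) (trans (+-identityʳ _) (sum-bitRuns L x<))

code-≤1 : ∀ L x → All (_≤ 1) (code L x)
code-≤1 L x = All.++⁺ (All.concat⁺ (All.applyUpTo⁺₁ _ L (λ {b} _ → All.replicate⁺ (2 ^ b) (bit≤1 b x)))) (z≤n ∷ [])

code-block : ∀ {b L} x → b < L → Σ (List ℕ) λ rest → code L x ≡ bitRuns b x ++ (replicate (2 ^ b) (bit b x) ++ rest)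
code-block {b} {L} x b<L = R ++ [ 0 ] , (begin
  code L x                                        ≡⟨ cong (λ l → code l x) (sym (m+[n∸m]≡n b<L)) ⟩
  bitRuns (suc b + n) x ++ [ 0 ]                  ≡⟨ cong (_++ [ 0 ]) (bitRuns-+ (suc b) n x) ⟩
  (bitRuns (suc b) x ++ R) ++ [ 0 ]               ≡⟨ cong (λ u → (u ++ R) ++ [ 0 ]) (bitRuns-suc b x) ⟩
  ((bitRuns b x ++ run) ++ R) ++ [ 0 ]            ≡⟨ ++-assoc (bitRuns b x ++ run) R [ 0 ] ⟩
  (bitRuns b x ++ run) ++ (R ++ [ 0 ])            ≡⟨ ++-assoc (bitRuns b x) run (R ++ [ 0 ]) ⟩
  bitRuns b x ++ (run ++ (R ++ [ 0 ]))            ∎)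
  where
  n = L ∸ suc b
  run = replicate (2 ^ b) (bit b x)
  R = concat (applyUpTo (λ c → replicate (2 ^ (suc b + c)) (bit (suc b + c) x)) n)

at-code : ∀ {b L} x {s} → b < L → s < 2 ^ b → at (code L x) (blockStart b + s) ≡ bit b x
at-code {b} {L} x {s} b<L s< = begin
  at (code L x) (blockStart b + s)                               ≡⟨ cong₂ at eq (cong (_+ s) (sym (length-bitRuns b x))) ⟩
  at (bitRuns b x ++ (run ++ rest)) (length (bitRuns b x) + s)   ≡⟨ at-++ʳ (bitRuns b x) (run ++ rest) s ⟩
  at (run ++ rest) s                                             ≡⟨ at-++ˡ run rest (subst (s <_) (sym (length-replicate (2 ^ b))) s<) ⟩
  at run s                                                       ≡⟨ at-replicate (2 ^ b) (bit b x) s< ⟩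
  bit b x                                                        ∎
  where
  run = replicate (2 ^ b) (bit b x)
  rest = proj₁ (code-block x b<L)
  eq = proj₂ (code-block x b<L)

at-code-last : ∀ L x → at (code L x) (blockStart L) ≡ 0
at-code-last L x = trans (cong (at (code L x)) (sym (trans (+-identityʳ _) (length-bitRuns L x)))) (at-++ʳ (bitRuns L x) [ 0 ] 0)

codeColumn : ℕ → ℕ → List ℕ
codeColumn L t = applyUpTo (λ x → at (code L x) t) (2 ^ suc L)

codeColumns : ℕ → List ℕ
codeColumns L = concat (applyUpTo (codeColumn L) (2 ^ L))

bitBlock : ℕ → ℕ → List ℕ
bitBlock L b = doubling b (bitPattern L b)

codeColumn-block : ∀ {b L s} → b < L → s < 2 ^ b → codeColumn L (blockStart b + s) ≡ bitPattern L b
codeColumn-block {b} {L} b<L s< =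
  trans (applyUpTo-cong (2 ^ suc L) (λ x _ → at-code x b<L s<)) (applyUpTo-bit-2^[1+L] (<⇒≤ b<L))

codeColumns-prefix : ∀ {L} b → b ≤ L → concat (applyUpTo (codeColumn L) (blockStart b)) ≡ concat (applyUpTo (bitBlock L) b)
codeColumns-prefix         zero    _   = refl
codeColumns-prefix {L = L} (suc b) b<L = begin
  concat (applyUpTo (codeColumn L) (blockStart b + 2 ^ b))
    ≡⟨ cong concat (applyUpTo-++ (blockStart b) (2 ^ b) (codeColumn L)) ⟩
  concat (applyUpTo (codeColumn L) (blockStart b) ++ applyUpTo (codeColumn L ∘ (blockStart b +_)) (2 ^ b))
    ≡⟨ concat-++ (applyUpTo (codeColumn L) (blockStart b)) _ ⟨
  concat (applyUpTo (codeColumn L) (blockStart b)) ++ concat (applyUpTo (codeColumn L ∘ (blockStart b +_)) (2 ^ b))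
    ≡⟨ cong₂ _++_ (codeColumns-prefix b (<⇒≤ b<L)) block ⟩
  concat (applyUpTo (bitBlock L) b) ++ bitBlock L b
    ≡⟨ concat-applyUpTo-suc b (bitBlock L) ⟨
  concat (applyUpTo (bitBlock L) (suc b))
    ∎
  where
  block : concat (applyUpTo (codeColumn L ∘ (blockStart b +_)) (2 ^ b)) ≡ bitBlock L b
  block = concat-applyUpTo-2^ b (λ _ s< → codeColumn-block b<L s<)

codeColumn-last : ∀ L → codeColumn L (blockStart L) ≡ doubling (suc L) [ 0 ]
codeColumn-last L = begin
  codeColumn L (blockStart L)               ≡⟨ applyUpTo-cong (2 ^ suc L) (λ x _ → at-code-last L x) ⟩
  applyUpTo (const 0) (2 ^ suc L)       ≡⟨ applyUpTo-const (2 ^ suc L) 0 ⟩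
  replicate (2 ^ suc L) 0               ≡⟨ doubling-[ suc L ] 0 ⟨
  doubling (suc L) [ 0 ]                ∎

codeColumns-blocks : ∀ L → codeColumns L ≡ concat (applyUpTo (bitBlock L) L) ++ doubling (suc L) [ 0 ]
codeColumns-blocks L = begin
  concat (applyUpTo (codeColumn L) (2 ^ L))
    ≡⟨ cong (concat ∘ applyUpTo (codeColumn L)) (1+blockStart L) ⟨
  concat (applyUpTo (codeColumn L) (suc (blockStart L)))
    ≡⟨ concat-applyUpTo-suc (blockStart L) (codeColumn L) ⟩
  concat (applyUpTo (codeColumn L) (blockStart L)) ++ codeColumn L (blockStart L)
    ≡⟨ cong₂ _++_ (codeColumns-prefix L ≤-refl) (codeColumn-last L) ⟩
  concat (applyUpTo (bitBlock L) L) ++ doubling (suc L) [ 0 ]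
    ∎

rowA : ℕ → ℕ → List ℕ
rowA L x = replicate (2 ^ L) (lsb x) ++ code L x

colB : ℕ → ℕ → List ℕ
colB L y = code L y ++ replicate (2 ^ L) (lsb (suc y))

Amat : ∀ L → Matrix (2 ^ suc L)
Amat L i k = at (rowA L (toℕ i)) (toℕ k)

Bmat : ∀ L → Matrix (2 ^ suc L)
Bmat L k j = at (colB L (toℕ j)) (toℕ k)

length-rowA : ∀ L x → length (rowA L x) ≡ 2 ^ suc L
length-rowA L x = trans (length-++ (replicate (2 ^ L) (lsb x)))
  (trans (cong₂ _+_ (length-replicate (2 ^ L)) (length-code L x)) (sym (2^-suc L)))

length-colB : ∀ L y → length (colB L y) ≡ 2 ^ suc L
length-colB L y = trans (length-++ (code L y))
  (trans (cong₂ _+_ (length-code L y) (length-replicate (2 ^ L))) (sym (2^-suc L)))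

row-Amat : ∀ L i → row (Amat L) i ≡ rowA L (toℕ i)
row-Amat L i = tabulate-at (rowA L (toℕ i)) (length-rowA L (toℕ i))

col-Bmat : ∀ L j → col (Bmat L) j ≡ colB L (toℕ j)
col-Bmat L j = tabulate-at (colB L (toℕ j)) (length-colB L (toℕ j))

Amat-zero-one : ∀ L → IsZeroOne (Amat L)
Amat-zero-one L i = at-≤1 (All.++⁺ (All.replicate⁺ (2 ^ L) (lsb≤1 (toℕ i))) (code-≤1 L (toℕ i))) ∘ toℕ

Bmat-zero-one : ∀ L → IsZeroOne (Bmat L)
Bmat-zero-one L k j = at-≤1 (All.++⁺ (code-≤1 L (toℕ j)) (All.replicate⁺ (2 ^ L) (lsb≤1 (suc (toℕ j))))) (toℕ k)

at-rowA-low : ∀ L x {k} → k < 2 ^ L → at (rowA L x) k ≡ lsb x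
at-rowA-low L x {k} k< =
  trans (at-++ˡ (replicate (2 ^ L) (lsb x)) (code L x) (subst (k <_) (sym (length-replicate (2 ^ L))) k<))
        (at-replicate (2 ^ L) (lsb x) k<)

at-rowA-high : ∀ L x t → at (rowA L x) (2 ^ L + t) ≡ at (code L x) t
at-rowA-high L x t =
  trans (cong (λ n → at (rowA L x) (n + t)) (sym (length-replicate (2 ^ L)))) (at-++ʳ (replicate (2 ^ L) (lsb x)) (code L x) t)

at-colB-low : ∀ L y {k} → k < 2 ^ L → at (colB L y) k ≡ at (code L y) k
at-colB-low L y {k} k< = at-++ˡ (code L y) _ (subst (k <_) (sym (length-code L y)) k<)

at-colB-high : ∀ L y {t} → t < 2 ^ L → at (colB L y) (2 ^ L + t) ≡ lsb (suc y)
at-colB-high L y {t} t< = begin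
  at (colB L y) (2 ^ L + t)                  ≡⟨ cong (λ n → at (colB L y) (n + t)) (sym (length-code L y)) ⟩
  at (colB L y) (length (code L y) + t)      ≡⟨ at-++ʳ (code L y) _ t ⟩
  at (replicate (2 ^ L) (lsb (suc y))) t     ≡⟨ at-replicate (2 ^ L) (lsb (suc y)) t< ⟩
  lsb (suc y)                                ∎

entryC : ℕ → ℕ → ℕ → ℕ
entryC L x y = dot (rowA L x) (colB L y)

⊗-entryC : ∀ L i j → (Amat L ⊗ Bmat L) i j ≡ entryC L (toℕ i) (toℕ j)
⊗-entryC L i j = trans (⊗-dot (Amat L) (Bmat L) i j) (cong₂ dot (row-Amat L i) (col-Bmat L j))

entryC-formula : ∀ L {x y} → x < 2 ^ L → y < 2 ^ L → entryC L x y ≡ lsb x * y + x * lsb (suc y)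
entryC-formula L {x} {y} x< y< = begin
  dot (replicate (2 ^ L) (lsb x) ++ code L x) (code L y ++ replicate (2 ^ L) (lsb (suc y)))
    ≡⟨ dot-++ (replicate (2 ^ L) (lsb x)) (code L y) (trans (length-replicate (2 ^ L)) (sym (length-code L y))) ⟩
  dot (replicate (2 ^ L) (lsb x)) (code L y) + dot (code L x) (replicate (2 ^ L) (lsb (suc y)))
    ≡⟨ cong₂ _+_ (dot-replicateˡ (lsb x) (code L y) (length-code L y))
                 (dot-replicateʳ (code L x) (lsb (suc y)) (length-code L x)) ⟩
  lsb x * sum (code L y) + sum (code L x) * lsb (suc y)
    ≡⟨ cong₂ (λ u v → lsb x * u + v * lsb (suc y)) (sum-code L y<) (sum-code L x<) ⟩
  lsb x * y + x * lsb (suc y)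
    ∎

flatten-entries : ∀ {N} (M : Matrix N) (f : ℕ → ℕ → ℕ) → (∀ i j → M i j ≡ f (toℕ i) (toℕ j)) →
                  flatten M ≡ concat (applyUpTo (λ x → applyUpTo (f x) N) N)
flatten-entries {N} M f M≗f = cong concat (tabulate-toℕ≗ N _ (λ i → tabulate-toℕ≗ N (f (toℕ i)) (M≗f i)))

flatten-Aᵀ : ∀ L → flatten (transpose (Amat L)) ≡ doubling L (bitPattern L 0) ++ codeColumns L
flatten-Aᵀ L = begin
  flatten (transpose (Amat L))
    ≡⟨ flatten-entries (transpose (Amat L)) (λ k x → at (rowA L x) k) (λ _ _ → refl) ⟩
  concat (applyUpTo columnA (2 ^ suc L))
    ≡⟨ concat-applyUpTo-halves L columnA ⟩
  concat (applyUpTo columnA (2 ^ L)) ++ concat (applyUpTo (columnA ∘ (2 ^ L +_)) (2 ^ L))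
    ≡⟨ cong₂ _++_ (concat-applyUpTo-2^ L low) (cong concat high) ⟩
  doubling L (bitPattern L 0) ++ codeColumns L
    ∎
  where
  columnA : ℕ → List ℕ
  columnA k = applyUpTo (λ x → at (rowA L x) k) (2 ^ suc L)
  low : ∀ k → k < 2 ^ L → columnA k ≡ bitPattern L 0
  low k k< = trans (applyUpTo-cong (2 ^ suc L) (λ x _ → at-rowA-low L x k<)) (applyUpTo-bit-2^[1+L] {L = L} z≤n)
  high : applyUpTo (columnA ∘ (2 ^ L +_)) (2 ^ L) ≡ applyUpTo (codeColumn L) (2 ^ L)
  high = applyUpTo-cong (2 ^ L) (λ t _ → applyUpTo-cong (2 ^ suc L) (λ x _ → at-rowA-high L x t))

flatten-B : ∀ L → flatten (Bmat L) ≡ codeColumns L ++ doubling L (doubling L (1 ∷ 0 ∷ []))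
flatten-B L = begin
  flatten (Bmat L)
    ≡⟨ flatten-entries (Bmat L) (λ k y → at (colB L y) k) (λ _ _ → refl) ⟩
  concat (applyUpTo rowB (2 ^ suc L))
    ≡⟨ concat-applyUpTo-halves L rowB ⟩
  concat (applyUpTo rowB (2 ^ L)) ++ concat (applyUpTo (rowB ∘ (2 ^ L +_)) (2 ^ L))
    ≡⟨ cong₂ _++_ (cong concat low) (concat-applyUpTo-2^ L high) ⟩
  codeColumns L ++ doubling L (doubling L (1 ∷ 0 ∷ []))
    ∎
  where
  rowB : ℕ → List ℕ
  rowB k = applyUpTo (λ y → at (colB L y) k) (2 ^ suc L)
  low : applyUpTo rowB (2 ^ L) ≡ applyUpTo (codeColumn L) (2 ^ L)
  low = applyUpTo-cong (2 ^ L) (λ k k< → applyUpTo-cong (2 ^ suc L) (λ y _ → at-colB-low L y k<))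
  high : ∀ t → t < 2 ^ L → rowB (2 ^ L + t) ≡ doubling L (1 ∷ 0 ∷ [])
  high t t< = trans (applyUpTo-cong (2 ^ suc L) (λ y _ → at-colB-high L y t<)) (applyUpTo-lsb∘suc L)

module _ (L : ℕ) where

  private
    C = Amat L ⊗ Bmat L
    N = 2 ^ suc L

  row-C : ∀ i → row C i ≡ applyUpTo (entryC L (toℕ i)) N
  row-C i = tabulate-toℕ≗ N (entryC L (toℕ i)) (⊗-entryC L i)

  col-C : ∀ j → col C j ≡ applyUpTo (λ x → entryC L x (toℕ j)) N
  col-C j = tabulate-toℕ≗ N (λ x → entryC L x (toℕ j)) (λ i → ⊗-entryC L i j)

  flatten-C : flatten C ≡ concat (applyUpTo (λ x → applyUpTo (entryC L x) N) N)
  flatten-C = flatten-entries C (entryC L) (⊗-entryC L)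

  flatten-Cᵀ : flatten (transpose C) ≡ concat (applyUpTo (λ y → applyUpTo (λ x → entryC L x y) N) N)
  flatten-Cᵀ = flatten-entries (transpose C) (λ y x → entryC L x y) (λ j i → ⊗-entryC L i j)

module _ {A : Set} (_≟_ : DecidableEquality A) where

  cons-run : ∀ σ ℓ {w} (r : RLE A w) → Σ (RLE A (replicate ℓ σ ++ w)) λ r′ → rleSize r′ ≤ suc (rleSize r)
  cons-run σ zero    r = r , n≤1+n (rleSize r)
  cons-run σ (suc ℓ) record { runs = [] ; decodes = refl } =
    record { runs = (σ , suc ℓ) ∷ [] ; valid = s≤s z≤n ; decodes = refl } , ≤-refl
  cons-run σ (suc ℓ) record { runs = (τ , m) ∷ rs ; valid = v ; decodes = refl } with σ ≟ τ
  ... | yes refl = record { runs = (σ , suc ℓ + m) ∷ rs ; valid = lengthen rs v ; decodes = merged } , n≤1+n _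
    where
    lengthen : ∀ rs → ValidRLE ((σ , m) ∷ rs) → ValidRLE ((σ , suc ℓ + m) ∷ rs)
    lengthen []      _              = s≤s z≤n
    lengthen (_ ∷ _) (_ , σ≢ , v′) = s≤s z≤n , σ≢ , v′
    merged : replicate (suc ℓ + m) σ ++ decode rs ≡ replicate (suc ℓ) σ ++ (replicate m σ ++ decode rs)
    merged = trans (cong (_++ decode rs) (replicate-+ (suc ℓ) m σ)) (++-assoc (replicate (suc ℓ) σ) _ _)
  ... | no σ≢τ = record { runs = (σ , suc ℓ) ∷ (τ , m) ∷ rs ; valid = s≤s z≤n , σ≢τ , v ; decodes = refl } , ≤-refl

  rle-decode : ∀ rs → Σ (RLE A (decode rs)) λ r → rleSize r ≤ length rs
  rle-decode []             = record { runs = [] ; valid = tt ; decodes = refl } , z≤n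
  rle-decode ((σ , ℓ) ∷ rs) =
    let r , r≤ = rle-decode rs
        r′ , r′≤ = cons-run σ ℓ r
    in r′ , ≤-trans r′≤ (s≤s r≤)

  rle-of : ∀ rs {w} → decode rs ≡ w → Σ (RLE A w) λ r → rleSize r ≤ length rs
  rle-of rs refl = rle-decode rs

decode-++ : ∀ {A : Set} (rs ss : List (A × ℕ)) → decode (rs ++ ss) ≡ decode rs ++ decode ss
decode-++ []             ss = refl
decode-++ ((σ , ℓ) ∷ rs) ss = trans (cong (replicate ℓ σ ++_) (decode-++ rs ss)) (sym (++-assoc (replicate ℓ σ) _ _))

decode-applyUpTo : ∀ {A : Set} n (f : ℕ → A × ℕ) →
                   decode (applyUpTo f n) ≡ concat (applyUpTo (λ b → replicate (proj₂ (f b)) (proj₁ (f b))) n)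
decode-applyUpTo zero    f = refl
decode-applyUpTo (suc n) f = cong (replicate (proj₂ (f 0)) (proj₁ (f 0)) ++_) (decode-applyUpTo n (f ∘ suc))

powerRuns : List (ℕ × ℕ) → List (ℕ × ℕ)
powerRuns = List.map (Product.map₂ (2 ^_))

piece : ℕ × ℕ → List ℕ
piece (v , d) = doubling d [ v ]

decode-powerRuns : ∀ rs → decode (powerRuns rs) ≡ concat (List.map piece rs)
decode-powerRuns []             = refl
decode-powerRuns ((v , d) ∷ rs) = cong₂ _++_ (sym (doubling-[ d ] v)) (decode-powerRuns rs)

decode-powerRuns-bits : ∀ L x → decode (powerRuns (applyUpTo (λ b → (bit b x , b)) L)) ≡ bitRuns L x
decode-powerRuns-bits L x =
  trans (cong decode (map-applyUpTo _ (Product.map₂ (2 ^_)) L)) (decode-applyUpTo L (λ b → (bit b x , 2 ^ b)))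

rowA-exponents : ℕ → ℕ → List (ℕ × ℕ)
rowA-exponents L x = (lsb x , L) ∷ applyUpTo (λ b → (bit b x , b)) L

colB-exponents : ℕ → ℕ → List (ℕ × ℕ)
colB-exponents L y = applyUpTo (λ b → (bit b y , b)) L ++ [ (0 , 0) ]

length-rowA-exponents : ∀ L x → length (rowA-exponents L x) ≡ suc L
length-rowA-exponents L x = cong suc (length-applyUpTo _ L)

length-colB-exponents : ∀ L y → length (colB-exponents L y) ≡ suc L
length-colB-exponents L y = trans (length-applyUpTo-++ L _ _) (+-comm L 1)

decode-rowA : ∀ L x → decode (powerRuns (rowA-exponents L x ++ [ (0 , 0) ])) ≡ rowA L x
decode-rowA L x = cong (replicate (2 ^ L) (lsb x) ++_) (begin
  decode (powerRuns (bits ++ [ (0 , 0) ]))          ≡⟨ cong decode (map-++ (Product.map₂ (2 ^_)) bits [ (0 , 0) ]) ⟩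
  decode (powerRuns bits ++ [ (0 , 1) ])            ≡⟨ decode-++ (powerRuns bits) [ (0 , 1) ] ⟩
  decode (powerRuns bits) ++ [ 0 ]                  ≡⟨ cong (_++ [ 0 ]) (decode-powerRuns-bits L x) ⟩
  code L x                                          ∎)
  where bits = applyUpTo (λ b → (bit b x , b)) L

decode-colB : ∀ L y → decode (powerRuns (colB-exponents L y ++ [ (lsb (suc y) , L) ])) ≡ colB L y
decode-colB L y = begin
  decode (powerRuns ((bits ++ [ (0 , 0) ]) ++ [ (lsb (suc y) , L) ]))
    ≡⟨ cong decode (trans (map-++ _ (bits ++ [ (0 , 0) ]) _) (cong (_++ [ (lsb (suc y) , 2 ^ L) ]) (map-++ _ bits _))) ⟩
  decode ((powerRuns bits ++ [ (0 , 1) ]) ++ [ (lsb (suc y) , 2 ^ L) ])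
    ≡⟨ trans (decode-++ (powerRuns bits ++ [ (0 , 1) ]) _)
             (cong (_++ (replicate (2 ^ L) (lsb (suc y)) ++ [])) (decode-++ (powerRuns bits) _)) ⟩
  (decode (powerRuns bits) ++ [ 0 ]) ++ replicate (2 ^ L) (lsb (suc y)) ++ []
    ≡⟨ cong₂ (λ u v → (u ++ [ 0 ]) ++ v) (decode-powerRuns-bits L y) (++-identityʳ _) ⟩
  colB L y
    ∎
  where bits = applyUpTo (λ b → (bit b y , b)) L

row-Amat-runs : ∀ L i → decode (powerRuns (rowA-exponents L (toℕ i) ++ [ (0 , 0) ])) ≡ row (Amat L) i
row-Amat-runs L i = trans (decode-rowA L (toℕ i)) (sym (row-Amat L i))

col-Bmat-runs : ∀ L j → decode (powerRuns (colB-exponents L (toℕ j) ++ [ (lsb (suc (toℕ j)) , L) ])) ≡ col (Bmat L) j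
col-Bmat-runs L j = trans (decode-colB L (toℕ j)) (sym (col-Bmat L j))

length-powerRuns-∷ʳ : ∀ rs r → length (powerRuns (rs ++ [ r ])) ≡ suc (length rs)
length-powerRuns-∷ʳ rs r = trans (length-map _ (rs ++ [ r ])) (trans (length-++ rs) (+-comm (length rs) 1))

powerRuns-rle : ∀ rs r {w} → decode (powerRuns (rs ++ [ r ])) ≡ w → Σ (RLE ℕ w) λ x → rleSize x ≤ suc (length rs)
powerRuns-rle rs r eq = map₂ (λ x≤ → ≤-trans x≤ (≤-reflexive (length-powerRuns-∷ʳ rs r))) (rle-of _≟_ (powerRuns (rs ++ [ r ])) eq)

row-Amat-rle : ∀ L i → Σ (RLE ℕ (row (Amat L) i)) λ r → rleSize r ≤ 2 + L
row-Amat-rle L i = map₂ (λ r≤ → ≤-trans r≤ (≤-reflexive (cong suc (length-rowA-exponents L (toℕ i)))))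
  (powerRuns-rle (rowA-exponents L (toℕ i)) (0 , 0) (row-Amat-runs L i))

col-Bmat-rle : ∀ L j → Σ (RLE ℕ (col (Bmat L) j)) λ r → rleSize r ≤ 2 + L
col-Bmat-rle L j = map₂ (λ r≤ → ≤-trans r≤ (≤-reflexive (cong suc (length-colB-exponents L (toℕ j)))))
  (powerRuns-rle (colB-exponents L (toℕ j)) (lsb (suc (toℕ j)) , L) (col-Bmat-runs L j))

-- Straight-line programs

lookup-∷ʳ-inject₁ : ∀ {n} (xs : Vec A n) x (j : Fin n) → Vec.lookup (xs Vec.∷ʳ x) (Fin.inject₁ j) ≡ Vec.lookup xs j
lookup-∷ʳ-inject₁ (y Vec.∷ ys) x Fin.zero    = refl
lookup-∷ʳ-inject₁ (y Vec.∷ ys) x (Fin.suc j) = lookup-∷ʳ-inject₁ ys x j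

lookup-∷ʳ-fromℕ : ∀ {n} (xs : Vec A n) x → Vec.lookup (xs Vec.∷ʳ x) (Fin.fromℕ n) ≡ x
lookup-∷ʳ-fromℕ Vec.[]       x = refl
lookup-∷ʳ-fromℕ (y Vec.∷ ys) x = lookup-∷ʳ-fromℕ ys x

lookup-∷ʳ : ∀ {n} (xs : Vec A n) x (j : Fin (suc n)) →
            (Σ (Fin n) λ j′ → Vec.lookup (xs Vec.∷ʳ x) j ≡ Vec.lookup xs j′) ⊎ Vec.lookup (xs Vec.∷ʳ x) j ≡ x
lookup-∷ʳ Vec.[]       x Fin.zero    = inj₂ refl
lookup-∷ʳ (y Vec.∷ ys) x Fin.zero    = inj₁ (Fin.zero , refl)
lookup-∷ʳ (y Vec.∷ ys) x (Fin.suc j) with lookup-∷ʳ ys x j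
... | inj₁ (j′ , eq) = inj₁ (Fin.suc j′ , eq)
... | inj₂ eq        = inj₂ eq

module _ {A : Set} where

  ruleExpansion : ∀ {n} → Prog A n → Rule A n → List A
  ruleExpansion p (inj₁ σ)       = [ σ ]
  ruleExpansion p (inj₂ (j , k)) = Vec.lookup (expansions p) j ++ Vec.lookup (expansions p) k

  expansions-▷ : ∀ {n} (p : Prog A n) r → expansions (p ▷ r) ≡ expansions p Vec.∷ʳ ruleExpansion p r
  expansions-▷ p (inj₁ σ)       = refl
  expansions-▷ p (inj₂ (j , k)) = refl

  lookup-▷ : ∀ {n} (p : Prog A n) r j →
             Vec.lookup (expansions (p ▷ r)) j ≡ Vec.lookup (expansions p Vec.∷ʳ ruleExpansion p r) j
  lookup-▷ p r j = cong (λ e → Vec.lookup e j) (expansions-▷ p r)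

  record Derives {n} (p : Prog A n) (w : List A) : Set where
    constructor derivation
    field
      rule    : Fin n
      expands : Vec.lookup (expansions p) rule ≡ w

  derives-▷ : ∀ {n} {p : Prog A n} r {w} → Derives p w → Derives (p ▷ r) w
  derives-▷ {p = p} r (derivation j eq) = derivation (Fin.inject₁ j)
    (trans (lookup-▷ p r (Fin.inject₁ j)) (trans (lookup-∷ʳ-inject₁ (expansions p) _ j) eq))

  derives-new : ∀ {n} (p : Prog A n) r → Derives (p ▷ r) (ruleExpansion p r)
  derives-new {n} p r = derivation (Fin.fromℕ n)
    (trans (lookup-▷ p r (Fin.fromℕ n)) (lookup-∷ʳ-fromℕ (expansions p) _))

  generates-new : ∀ {n} (p : Prog A n) r → Vec.last (expansions (p ▷ r)) ≡ ruleExpansion p r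
  generates-new p r = trans (cong Vec.last (expansions-▷ p r)) (last-∷ʳ _ (expansions p))

  Compressible : List A → ℕ → Set
  Compressible w c = Σ (GrammarCompression A w) λ g → gcSize g ≤ c

  compressible-≤ : ∀ {w c c′} → c ≤ c′ → Compressible w c → Compressible w c′
  compressible-≤ c≤c′ = map₂ (λ g≤ → ≤-trans g≤ c≤c′)

  derives-▷⁻ : ∀ {n} (p : Prog A n) r {w} → Derives (p ▷ r) w → Derives p w ⊎ ruleExpansion p r ≡ w
  derives-▷⁻ p r (derivation j eq) with lookup-∷ʳ (expansions p) (ruleExpansion p r) j
  ... | inj₁ (j′ , eq′) = inj₁ (derivation j′ (trans (sym eq′) (trans (sym (lookup-▷ p r j)) eq)))
  ... | inj₂ eq′        = inj₂ (trans (sym eq′) (trans (sym (lookup-▷ p r j)) eq))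

  derives⇒compression : ∀ {n} (p : Prog A n) {w} → Derives p w → Compressible w n
  derives⇒compression (p ▷ r) d with derives-▷⁻ p r d
  ... | inj₁ d′ = compressible-≤ (n≤1+n _) (derives⇒compression p d′)
  ... | inj₂ eq = record { k = _ ; prog = p ▷ r ; generates = trans (generates-new p r) eq } , ≤-refl

  data Adjacent : A × A → List A → Set where
    here  : ∀ {x y w} → Adjacent (x , y) (x ∷ y ∷ w)
    there : ∀ {xy z w} → Adjacent xy w → Adjacent xy (z ∷ w)

  Adjacent-++ˡ : ∀ {xy} u v → Adjacent xy u → Adjacent xy (u ++ v)
  Adjacent-++ˡ (_ ∷ _ ∷ _) v here      = here
  Adjacent-++ˡ (_ ∷ u)     v (there a) = there (Adjacent-++ˡ u v a)

  Adjacent-++ʳ : ∀ {xy} u v → Adjacent xy v → Adjacent xy (u ++ v)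
  Adjacent-++ʳ []      v a = a
  Adjacent-++ʳ (_ ∷ u) v a = there (Adjacent-++ʳ u v a)

  Adjacent-++⁻ : ∀ {x y} u v → Adjacent (x , y) (u ++ v) →
                 Adjacent (x , y) u ⊎ Adjacent (x , y) v ⊎ (last u ≡ just x × head v ≡ just y)
  Adjacent-++⁻ []          v           a         = inj₂ (inj₁ a)
  Adjacent-++⁻ (_ ∷ [])    (_ ∷ _)     here      = inj₂ (inj₂ (refl , refl))
  Adjacent-++⁻ (_ ∷ [])    v           (there a) = inj₂ (inj₁ a)
  Adjacent-++⁻ (_ ∷ _ ∷ _) v           here      = inj₁ here
  Adjacent-++⁻ (_ ∷ u@(_ ∷ _)) v       (there a) with Adjacent-++⁻ u v a
  ... | inj₁ a′ = inj₁ (there a′)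
  ... | inj₂ a′ = inj₂ a′

  Adjacent-applyUpTo : ∀ n (f : ℕ → A) {j} → suc j < n → Adjacent (f j , f (suc j)) (applyUpTo f n)
  Adjacent-applyUpTo (suc (suc n)) f {zero}  _         = here
  Adjacent-applyUpTo (suc n)       f {suc j} (s≤s j<n) = there (Adjacent-applyUpTo n (f ∘ suc) j<n)

  Adjacent-concat-applyUpTo : ∀ n (f : ℕ → List A) {j xy} → j < n → Adjacent xy (f j) → Adjacent xy (concat (applyUpTo f n))
  Adjacent-concat-applyUpTo (suc n) f {zero}  _         a = Adjacent-++ˡ (f 0) _ a
  Adjacent-concat-applyUpTo (suc n) f {suc j} (s≤s j<n) a = Adjacent-++ʳ (f 0) _ (Adjacent-concat-applyUpTo n (f ∘ suc) j<n a)

  crossings : ∀ {n} → Prog A n → List (Maybe A × Maybe A)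
  crossings []                 = []
  crossings (p ▷ inj₁ _)       = crossings p
  crossings (p ▷ inj₂ (j , k)) = (last (Vec.lookup (expansions p) j) , head (Vec.lookup (expansions p) k)) ∷ crossings p

  length-crossings : ∀ {n} (p : Prog A n) → length (crossings p) ≤ n
  length-crossings []           = z≤n
  length-crossings (p ▷ inj₁ _) = m≤n⇒m≤1+n (length-crossings p)
  length-crossings (p ▷ inj₂ _) = s≤s (length-crossings p)

  crossings-▷ : ∀ {n} (p : Prog A n) r {c} → c ∈ crossings p → c ∈ crossings (p ▷ r)
  crossings-▷ p (inj₁ _) c∈ = c∈
  crossings-▷ p (inj₂ _) c∈ = there c∈

  mutual
    adjacent-ruleExpansion : ∀ {n} (p : Prog A n) r {x y} → Adjacent (x , y) (ruleExpansion p r) →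
                             (just x , just y) ∈ crossings (p ▷ r)
    adjacent-ruleExpansion p (inj₁ σ)       (there ())
    adjacent-ruleExpansion p (inj₂ (j , k)) a with Adjacent-++⁻ (Vec.lookup (expansions p) j) _ a
    ... | inj₁ aʲ               = there (adjacent-derived p (derivation j refl) aʲ)
    ... | inj₂ (inj₁ aᵏ)        = there (adjacent-derived p (derivation k refl) aᵏ)
    ... | inj₂ (inj₂ (ex , ey)) = here (cong₂ _,_ (sym ex) (sym ey))

    adjacent-derived : ∀ {n} (p : Prog A n) {w x y} → Derives p w → Adjacent (x , y) w → (just x , just y) ∈ crossings p
    adjacent-derived (p ▷ r) d a with derives-▷⁻ p r d
    ... | inj₁ d′ = crossings-▷ p r (adjacent-derived p d′ a)
    ... | inj₂ eq = adjacent-ruleExpansion p r (subst (Adjacent _) (sym eq) a)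

  adjacent-crossing : ∀ {w} (g : GrammarCompression A w) {x y} → Adjacent (x , y) w →
                      (just x , just y) ∈ crossings (GrammarCompression.prog g)
  adjacent-crossing record { prog = p ▷ r ; generates = refl } a =
    adjacent-ruleExpansion p r (subst (Adjacent _) (generates-new p r) a)

  injective-adjacent≤gcSize : ∀ {M w} (g : GrammarCompression A w) (f : Fin M → A × A) → Injective _≡_ _≡_ f →
                              (∀ a → Adjacent (f a) w) → M ≤ gcSize g
  injective-adjacent≤gcSize g f f-inj adj =
    ≤-trans (injection⇒≤length (Product.map just just ∘ f) justs-inj (λ a → adjacent-crossing g (adj a)))
            (length-crossings (GrammarCompression.prog g))
    where
    justs-inj : Injective _≡_ _≡_ (Product.map just just ∘ f)
    justs-inj eq = f-inj (cong₂ _,_ (just-injective (cong proj₁ eq)) (just-injective (cong proj₂ eq)))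

  adjacent-pairs≤gcSize : ∀ {M w} (g : GrammarCompression A w) (f : ℕ → A × A) → Injective _≡_ _≡_ f →
                          (∀ {a} → a < M → Adjacent (f a) w) → M ≤ gcSize g
  adjacent-pairs≤gcSize g f f-inj adj = injective-adjacent≤gcSize g (f ∘ toℕ) (toℕ-injective ∘ f-inj) (adj ∘ toℕ<n)

  adjacent-grid≤gcSize : ∀ {m n w} (g : GrammarCompression A w) (f : ℕ → ℕ → A × A) →
                         (∀ {a b c d} → f a b ≡ f c d → a ≡ c × b ≡ d) →
                         (∀ {a b} → a < m → b < n → Adjacent (f a b) w) → m * n ≤ gcSize g
  adjacent-grid≤gcSize {m} {n} g f f-inj adj =
    injective-adjacent≤gcSize g (uncurry f′ ∘ Fin.remQuot {m} n) remQuot-inj (λ _ → adj (toℕ<n _) (toℕ<n _))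
    where
    f′ : Fin m → Fin n → A × A
    f′ a b = f (toℕ a) (toℕ b)
    remQuot-inj : Injective _≡_ _≡_ (uncurry f′ ∘ Fin.remQuot {m} n)
    remQuot-inj {i} {j} eq = begin
      i                                           ≡⟨ combine-remQuot {m} n i ⟨
      uncurry Fin.combine (Fin.remQuot {m} n i)   ≡⟨ cong (uncurry Fin.combine) remQuot≡ ⟩
      uncurry Fin.combine (Fin.remQuot {m} n j)   ≡⟨ combine-remQuot {m} n j ⟩
      j                                           ∎
      where remQuot≡ = uncurry (cong₂ _,_) (Product.map toℕ-injective toℕ-injective (f-inj eq))

module _ {A : Set} where

  _≼_ : ∀ {n m} → Prog A n → Prog A m → Set
  p ≼ q = ∀ {w} → Derives p w → Derives q w

  record Extension {n} (p : Prog A n) (c : ℕ) (P : ∀ {m} → Prog A m → Set) : Set where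
    constructor extension
    field
      {size}   : ℕ
      program  : Prog A size
      bounded  : size ≤ c + n
      keeps    : p ≼ program
      property : P program

  return : ∀ {n} {p : Prog A n} {P : ∀ {m} → Prog A m → Set} → P p → Extension p 0 P
  return {p = p} x = extension p ≤-refl (λ d → d) x

  bind : ∀ {n} {p : Prog A n} {c₁ c₂} {P Q : ∀ {m} → Prog A m → Set} → Extension p c₁ P →
         (∀ {m} {q : Prog A m} → p ≼ q → P q → Extension q c₂ Q) → Extension p (c₁ + c₂) Q
  bind {n} {c₁ = c₁} {c₂} (extension q q≤ p≼q x) k with k p≼q x
  ... | extension q′ q′≤ q≼q′ y = extension q′ bound (q≼q′ ∘ p≼q) y
    where
    bound = ≤-trans q′≤ (≤-trans (+-monoʳ-≤ c₂ q≤)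
                                 (≤-reflexive (trans (sym (+-assoc c₂ c₁ n)) (cong (_+ n) (+-comm c₂ c₁)))))

  weaken : ∀ {n} {p : Prog A n} {c c′} {P : ∀ {m} → Prog A m → Set} → c ≤ c′ → Extension p c P → Extension p c′ P
  weaken {n} c≤c′ (extension q q≤ p≼q x) = extension q (≤-trans q≤ (+-monoˡ-≤ n c≤c′)) p≼q x

  map≼ : ∀ {n} {p : Prog A n} {c} {P Q : ∀ {m} → Prog A m → Set} → (∀ {m} {q : Prog A m} → p ≼ q → P q → Q q) →
         Extension p c P → Extension p c Q
  map≼ f (extension q q≤ p≼q x) = extension q q≤ p≼q (f p≼q x)

  extend : ∀ {n} (p : Prog A n) r → Extension p 1 (λ q → Derives q (ruleExpansion p r))
  extend p r = extension (p ▷ r) ≤-refl (derives-▷ r) (derives-new p r)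

  append : ∀ {n} {p : Prog A n} {u v} → Derives p u → Derives p v → Extension p 1 (λ q → Derives q (u ++ v))
  append {p = p} (derivation j refl) (derivation k refl) = extend p (inj₂ (j , k))

  doublings : ∀ {n} {p : Prog A n} {u} → Derives p u → ∀ e →
              Extension p e (λ q → ∀ {d} → d ≤ e → Derives q (doubling d u))
  doublings du zero    = return λ { z≤n → du }
  doublings {u = u} du (suc e) = weaken (≤-reflexive (+-comm e 1)) (bind (doublings du e) λ _ ds →
    map≼ (λ q≼ d₊ → add q≼ ds d₊) (append (ds ≤-refl) (ds ≤-refl)))
    where
    add : ∀ {m m′} {q : Prog A m} {q′ : Prog A m′} → q ≼ q′ → (∀ {d} → d ≤ e → Derives q (doubling d u)) →
          Derives q′ (doubling (suc e) u) → ∀ {d} → d ≤ suc e → Derives q′ (doubling d u)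
    add q≼ ds d₊ d≤ with m≤n⇒m<n∨m≡n d≤
    ... | inj₁ d<  = q≼ (ds (s≤s⁻¹ d<))
    ... | inj₂ refl = d₊

  doubled : ∀ {n} {p : Prog A n} {u} → Derives p u → ∀ e → Extension p e (λ q → Derives q (doubling e u))
  doubled du e = map≼ (λ _ ds → ds ≤-refl) (doublings du e)

  concatenation : ∀ {n} {p : Prog A n} {ws w} → All (Derives p) ws → Derives p w →
                  Extension p (length ws) (λ q → Derives q (concat ws ++ w))
  concatenation []                         dw = return dw
  concatenation {ws = u ∷ us} {w} (du ∷ dus) dw = weaken (≤-reflexive (+-comm (length us) 1)) (
    bind (concatenation dus dw) λ p≼q drest →
    map≼ (λ {q = q} _ → subst (Derives q) (sym (++-assoc u (concat us) w))) (append (p≼q du) drest))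

  compress : ∀ {c w} → Extension [] c (λ q → Derives q w) → Compressible w c
  compress {c} (extension q q≤ _ dw) = compressible-≤ (≤-trans q≤ (≤-reflexive (+-identityʳ c))) (derives⇒compression q dw)

-- Compressing A and B

Bits : ℕ → ∀ {m} → Prog ℕ m → Set
Bits K q = ∀ {v d} → v ≤ 1 → d ≤ K → Derives q (piece (v , d))

Bits-≼ : ∀ {K n m} {p : Prog ℕ n} {q : Prog ℕ m} → p ≼ q → Bits K p → Bits K q
Bits-≼ p≼q B v≤ d≤ = p≼q (B v≤ d≤)

Bits-≤ : ∀ {K K′ m} {q : Prog ℕ m} → K′ ≤ K → Bits K q → Bits K′ q
Bits-≤ K′≤K B v≤ d≤ = B v≤ (≤-trans d≤ K′≤K)

Pieces : ℕ → ℕ → ∀ {m} → Prog ℕ m → Set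
Pieces σ K q = ∀ {d} → d ≤ K → Derives q (piece (σ , d))

derive-pieces : ∀ {n} (p : Prog ℕ n) σ K → Extension p (suc K) (Pieces σ K)
derive-pieces p σ K = bind (extend p (inj₁ σ)) λ _ dσ → doublings dσ K

derive-bits : ∀ {n} (p : Prog ℕ n) K → Extension p (suc K + suc K) (Bits K)
derive-bits p K = bind (derive-pieces p 0 K) λ {q = q} _ zeros →
  map≼ {p = q} {P = Pieces 1 K} (λ {q = q′} q≼ ones → both {q = q′} (λ d≤ → q≼ (zeros d≤)) ones) (derive-pieces q 1 K)
  where
  both : ∀ {m} {q : Prog ℕ m} → Pieces 0 K q → Pieces 1 K q → Bits K q
  both zeros ones z≤n       d≤ = zeros d≤
  both zeros ones (s≤s z≤n) d≤ = ones d≤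

Small : ℕ → ℕ × ℕ → Set
Small K (v , d) = v ≤ 1 × d ≤ K

bits-small : ∀ L x → All (Small L) (applyUpTo (λ b → (bit b x , b)) L)
bits-small L x = All.applyUpTo⁺₁ _ L (λ {b} b<L → bit≤1 b x , <⇒≤ b<L)

powerRuns-compressible : ∀ K rs r → All (Small K) rs → Small K r →
                        Compressible (decode (powerRuns (rs ++ [ r ]))) (suc K + suc K + length rs)
powerRuns-compressible K rs r small-rs (v≤ , d≤) = subst (λ w → Compressible w _) word
  (compress (bind (derive-bits [] K) λ _ B → weaken (≤-reflexive (length-map piece rs))
    (concatenation (All.map⁺ (All.map (λ { (v≤ , d≤) → B v≤ d≤ }) small-rs)) (B v≤ d≤))))
  where
  word : concat (List.map piece rs) ++ piece r ≡ decode (powerRuns (rs ++ [ r ]))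
  word = begin
    concat (List.map piece rs) ++ piece r               ≡⟨ cong (concat (List.map piece rs) ++_) (++-identityʳ (piece r)) ⟨
    concat (List.map piece rs) ++ concat [ piece r ]    ≡⟨ concat-++ (List.map piece rs) [ piece r ] ⟩
    concat (List.map piece rs ++ [ piece r ])           ≡⟨ cong concat (map-++ piece rs [ r ]) ⟨
    concat (List.map piece (rs ++ [ r ]))               ≡⟨ decode-powerRuns (rs ++ [ r ]) ⟨
    decode (powerRuns (rs ++ [ r ]))                    ∎

row-Amat-compressible : ∀ L i → Compressible (row (Amat L) i) (suc L + suc L + suc L)
row-Amat-compressible L i = subst (λ w → Compressible w _) (row-Amat-runs L i)
  (compressible-≤ (≤-reflexive (cong (suc L + suc L +_) (length-rowA-exponents L x)))
    (powerRuns-compressible L (rowA-exponents L x) (0 , 0) ((lsb≤1 x , ≤-refl) ∷ bits-small L x) (z≤n , z≤n)))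
  where x = toℕ i

col-Bmat-compressible : ∀ L j → Compressible (col (Bmat L) j) (suc L + suc L + suc L)
col-Bmat-compressible L j = subst (λ w → Compressible w _) (col-Bmat-runs L j)
  (compressible-≤ (≤-reflexive (cong (suc L + suc L +_) (length-colB-exponents L y)))
    (powerRuns-compressible L (colB-exponents L y) (lsb (suc y) , L)
      (All.++⁺ (bits-small L y) ((z≤n , z≤n) ∷ [])) (lsb≤1 (suc y) , ≤-refl)))
  where y = toℕ j

derive-square : ∀ {n} {p : Prog ℕ n} {L a b} → a ≤ 1 → b ≤ 1 → Bits L p →
                Extension p (1 + L + L) (λ q → Derives q (doubling L (doubling L (a ∷ b ∷ []))))
derive-square {L = L} a≤ b≤ B = bind (bind (append (B a≤ z≤n) (B b≤ z≤n)) λ _ dab → doubled dab L) λ _ d → doubled d L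

derive-bitBlock : ∀ {n} {p : Prog ℕ n} {L b} → b ≤ L → Bits L p → Extension p (suc L) (λ q → Derives q (bitBlock L b))
derive-bitBlock {L = L} {b} b≤L B = weaken (≤-reflexive (cong suc (m∸n+n≡m b≤L)))
  (bind (bind (append (B z≤n b≤L) (B (s≤s z≤n) b≤L)) λ _ d → doubled d (L ∸ b)) λ _ d → doubled d b)

Blocks : ℕ → ℕ → ∀ {m} → Prog ℕ m → Set
Blocks L k q = ∀ {b} → b < k → Derives q (bitBlock L b)

derive-bitBlocks : ∀ {n} {p : Prog ℕ n} {L} k → k ≤ L → Bits L p → Extension p (k * suc L) (Blocks L k)
derive-bitBlocks zero _ B = return (λ ())
derive-bitBlocks {L = L} (suc k) k<L B = weaken (≤-reflexive (+-comm (k * suc L) (suc L)))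
  (bind (derive-bitBlocks k (<⇒≤ k<L) B) λ {q = q} p≼q old →
   map≼ {p = q} (λ q≼ new → add q≼ old new) (derive-bitBlock (<⇒≤ k<L) (Bits-≼ p≼q B)))
  where
  add : ∀ {m m′} {q : Prog ℕ m} {q′ : Prog ℕ m′} → q ≼ q′ → Blocks L k q → Derives q′ (bitBlock L k) →
        Blocks L (suc k) q′
  add q≼ old new b<1+k with m≤n⇒m<n∨m≡n (s≤s⁻¹ b<1+k)
  ... | inj₁ b<k  = q≼ (old b<k)
  ... | inj₂ refl = new

strongCost : ℕ → ℕ
strongCost L = suc (suc L) + suc (suc L) + (1 + L + L + (L * suc L + suc L))

strongCost≤ : ∀ L → strongCost L ≤ 16 * (suc L * suc L)
strongCost≤ L = subst (strongCost L ≤_) (identity L) (m≤m+n _ (15 * (L * L) + 26 * L + 10))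
  where
  identity : ∀ L → suc (suc L) + suc (suc L) + (1 + L + L + (L * suc L + suc L)) + (15 * (L * L) + 26 * L + 10)
                   ≡ 16 * (suc L * suc L)
  identity = solve-∀

flatten-Aᵀ-compressible : ∀ L → Compressible (flatten (transpose (Amat L))) (strongCost L)
flatten-Aᵀ-compressible L = subst (λ w → Compressible w (strongCost L)) word (compress (
  bind (derive-bits [] (suc L)) λ _ B →
  bind (derive-square z≤n (s≤s z≤n) (Bits-≤ (n≤1+n L) B)) λ p≼q dM →
  bind (derive-bitBlocks L ≤-refl (Bits-≼ p≼q (Bits-≤ (n≤1+n L) B))) λ q≼r blocks →
  weaken (≤-reflexive (cong suc (length-applyUpTo (bitBlock L) L)))
    (concatenation (q≼r dM ∷ All.applyUpTo⁺₁ (bitBlock L) L blocks) (q≼r (p≼q (B z≤n ≤-refl))))))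
  where
  M = doubling L (bitPattern L 0)
  word : concat (M ∷ applyUpTo (bitBlock L) L) ++ doubling (suc L) [ 0 ] ≡ flatten (transpose (Amat L))
  word = begin
    (M ++ concat (applyUpTo (bitBlock L) L)) ++ doubling (suc L) [ 0 ]  ≡⟨ ++-assoc M _ _ ⟩
    M ++ (concat (applyUpTo (bitBlock L) L) ++ doubling (suc L) [ 0 ])  ≡⟨ cong (M ++_) (codeColumns-blocks L) ⟨
    M ++ codeColumns L                                                  ≡⟨ flatten-Aᵀ L ⟨
    flatten (transpose (Amat L))                                        ∎

flatten-B-compressible : ∀ L → Compressible (flatten (Bmat L)) (strongCost L)
flatten-B-compressible L = subst (λ w → Compressible w (strongCost L)) word (compress (
  bind (derive-bits [] (suc L)) λ _ B →
  bind (derive-square (s≤s z≤n) z≤n (Bits-≤ (n≤1+n L) B)) λ p≼q dM →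
  bind (derive-bitBlocks L ≤-refl (Bits-≼ p≼q (Bits-≤ (n≤1+n L) B))) λ q≼r blocks →
  weaken (≤-reflexive (trans (length-applyUpTo-++ L (bitBlock L) _) (+-comm L 1)))
    (concatenation (All.++⁺ (All.applyUpTo⁺₁ (bitBlock L) L blocks) (q≼r (p≼q (B z≤n ≤-refl)) ∷ [])) (q≼r dM))))
  where
  M = doubling L (doubling L (1 ∷ 0 ∷ []))
  blocks = applyUpTo (bitBlock L) L
  zeros = doubling (suc L) [ 0 ]
  word : concat (blocks ++ [ zeros ]) ++ M ≡ flatten (Bmat L)
  word = begin
    concat (blocks ++ [ zeros ]) ++ M              ≡⟨ cong (_++ M) (concat-++ blocks [ zeros ]) ⟨
    (concat blocks ++ (zeros ++ [])) ++ M          ≡⟨ cong (λ z → (concat blocks ++ z) ++ M) (++-identityʳ zeros) ⟩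
    (concat blocks ++ zeros) ++ M                  ≡⟨ cong (_++ M) (codeColumns-blocks L) ⟨
    codeColumns L ++ M                             ≡⟨ flatten-B L ⟨
    flatten (Bmat L)                               ∎

-- Lower bounds for the product

rowPair : ℕ → ℕ → ℕ × ℕ
rowPair a b = (2 * b + (1 + 2 * a) , 1 + 2 * b)

colPair : ℕ → ℕ → ℕ × ℕ
colPair a b = (2 * a , 2 * b + (1 + 2 * a))

rowPair-injective : ∀ a b c d → rowPair a b ≡ rowPair c d → a ≡ c × b ≡ d
rowPair-injective a b c d eq with *-cancelˡ-≡ b d 2 (suc-injective (cong proj₂ eq))
... | refl = *-cancelˡ-≡ a c 2 (suc-injective (+-cancelˡ-≡ (2 * b) _ _ (cong proj₁ eq))) , refl

colPair-injective : ∀ a b c d → colPair a b ≡ colPair c d → a ≡ c × b ≡ d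
colPair-injective a b c d eq with *-cancelˡ-≡ a c 2 (cong proj₁ eq)
... | refl = refl , *-cancelˡ-≡ b d 2 (+-cancelʳ-≡ (1 + 2 * a) _ _ (cong proj₂ eq))

module ProductLowerBounds (L₀ : ℕ) where

  private
    L = suc L₀
    h = 2 ^ L₀
    N = 2 ^ suc L
    C = Amat L ⊗ Bmat L

  1+2a<2^L : ∀ {a} → a < h → 1 + 2 * a < 2 ^ L
  1+2a<2^L {a} a<h = subst (_≤ 2 * h) (*-suc 2 a) (*-monoʳ-≤ 2 a<h)

  2a<2^L : ∀ {a} → a < h → 2 * a < 2 ^ L
  2a<2^L a<h = ≤-trans (n≤1+n _) (1+2a<2^L a<h)

  <2^L⇒<N : ∀ {k} → k < 2 ^ L → k < N
  <2^L⇒<N k< = ≤-trans k< (m≤m+n (2 ^ L) _)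

  entryC-odd-even : ∀ {a b} → a < h → b < h → entryC L (1 + 2 * a) (2 * b) ≡ 2 * b + (1 + 2 * a)
  entryC-odd-even {a} {b} a<h b<h = begin
    entryC L (1 + 2 * a) (2 * b)
      ≡⟨ entryC-formula L (1+2a<2^L a<h) (2a<2^L b<h) ⟩
    lsb (1 + 2 * a) * (2 * b) + (1 + 2 * a) * lsb (1 + 2 * b)
      ≡⟨ cong₂ (λ u v → u * (2 * b) + (1 + 2 * a) * v) (lsb[1+2*n]≡1 a) (lsb[1+2*n]≡1 b) ⟩
    1 * (2 * b) + (1 + 2 * a) * 1
      ≡⟨ cong₂ _+_ (*-identityˡ (2 * b)) (*-identityʳ (1 + 2 * a)) ⟩
    2 * b + (1 + 2 * a)
      ∎

  entryC-odd-odd : ∀ {a b} → a < h → b < h → entryC L (1 + 2 * a) (1 + 2 * b) ≡ 1 + 2 * b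
  entryC-odd-odd {a} {b} a<h b<h = begin
    entryC L (1 + 2 * a) (1 + 2 * b)
      ≡⟨ entryC-formula L (1+2a<2^L a<h) (1+2a<2^L b<h) ⟩
    lsb (1 + 2 * a) * (1 + 2 * b) + (1 + 2 * a) * lsb (2 * b)
      ≡⟨ cong₂ (λ u v → u * (1 + 2 * b) + (1 + 2 * a) * v) (lsb[1+2*n]≡1 a) (lsb[2*n]≡0 b) ⟩
    1 * (1 + 2 * b) + (1 + 2 * a) * 0
      ≡⟨ cong₂ _+_ (*-identityˡ (1 + 2 * b)) (*-zeroʳ (1 + 2 * a)) ⟩
    1 + 2 * b + 0
      ≡⟨ +-identityʳ (1 + 2 * b) ⟩
    1 + 2 * b
      ∎

  entryC-even-even : ∀ {a b} → a < h → b < h → entryC L (2 * a) (2 * b) ≡ 2 * a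
  entryC-even-even {a} {b} a<h b<h = begin
    entryC L (2 * a) (2 * b)
      ≡⟨ entryC-formula L (2a<2^L a<h) (2a<2^L b<h) ⟩
    lsb (2 * a) * (2 * b) + 2 * a * lsb (1 + 2 * b)
      ≡⟨ cong₂ (λ u v → u * (2 * b) + 2 * a * v) (lsb[2*n]≡0 a) (lsb[1+2*n]≡1 b) ⟩
    2 * a * 1
      ≡⟨ *-identityʳ (2 * a) ⟩
    2 * a
      ∎

  adjacent-row : ∀ {a b} → a < h → b < h → Adjacent (rowPair a b) (applyUpTo (entryC L (1 + 2 * a)) N)
  adjacent-row {a} {b} a<h b<h = subst₂ (λ u v → Adjacent (u , v) _) (entryC-odd-even a<h b<h) (entryC-odd-odd a<h b<h)
    (Adjacent-applyUpTo N (entryC L (1 + 2 * a)) (<2^L⇒<N (1+2a<2^L b<h)))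

  adjacent-col : ∀ {a b} → a < h → b < h → Adjacent (colPair a b) (applyUpTo (λ x → entryC L x (2 * b)) N)
  adjacent-col {a} {b} a<h b<h = subst₂ (λ u v → Adjacent (u , v) _) (entryC-even-even a<h b<h) (entryC-odd-even a<h b<h)
    (Adjacent-applyUpTo N (λ x → entryC L x (2 * b)) (<2^L⇒<N (1+2a<2^L a<h)))

  odd-row-size : ∀ {i a} (g : GrammarCompression ℕ (row C i)) → toℕ i ≡ 1 + 2 * a → a < h → h ≤ gcSize g
  odd-row-size {i} {a} g i≡ a<h =
    adjacent-pairs≤gcSize g (rowPair a) (λ {b} {d} eq → proj₂ (rowPair-injective a b a d eq)) λ b<h →
      subst (Adjacent _) (sym (trans (row-C L i) (cong (λ x → applyUpTo (entryC L x) N) i≡))) (adjacent-row a<h b<h)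

  even-col-size : ∀ {j b} (g : GrammarCompression ℕ (col C j)) → toℕ j ≡ 2 * b → b < h → h ≤ gcSize g
  even-col-size {j} {b} g j≡ b<h =
    adjacent-pairs≤gcSize g (λ a → colPair a b) (λ {a} {c} eq → proj₁ (colPair-injective a b c b eq)) λ a<h →
      subst (Adjacent _) (sym (trans (col-C L j) (cong (λ y → applyUpTo (λ x → entryC L x y) N) j≡))) (adjacent-col a<h b<h)

  2^L≤N : 2 * h ≤ N
  2^L≤N = m≤m+n (2 ^ L) _

  rowWise-size : (g : RowWiseCompression C) → h * h ≤ rowWiseSize C g
  rowWise-size g = sumFin-lsb 1 h (gcSize ∘ g) (s≤s z≤n) 2^L≤N λ i i< lsb≡1 →
    odd-row-size (g i) (trans (n≡lsb[n]+2*⌊n/2⌋ (toℕ i)) (cong (_+ 2 * ⌊ toℕ i /2⌋) lsb≡1)) (⌊n/2⌋<m (toℕ i) i<)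

  colWise-size : (g : ColumnWiseCompression C) → h * h ≤ columnWiseSize C g
  colWise-size g = sumFin-lsb 0 h (gcSize ∘ g) z≤n 2^L≤N λ j j< lsb≡0 →
    even-col-size (g j) (trans (n≡lsb[n]+2*⌊n/2⌋ (toℕ j)) (cong (_+ 2 * ⌊ toℕ j /2⌋) lsb≡0)) (⌊n/2⌋<m (toℕ j) j<)

  strong-size : (g : StrongCompression C) → h * h ≤ strongSize C g
  strong-size (inj₁ g) = adjacent-grid≤gcSize g rowPair (λ {a} {b} {c} {d} → rowPair-injective a b c d)
    (λ a<h b<h → subst (Adjacent _) (sym (flatten-C L))
      (Adjacent-concat-applyUpTo N _ (<2^L⇒<N (1+2a<2^L a<h)) (adjacent-row a<h b<h)))
  strong-size (inj₂ g) = adjacent-grid≤gcSize g colPair (λ {a} {b} {c} {d} → colPair-injective a b c d)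
    (λ a<h b<h → subst (Adjacent _) (sym (flatten-Cᵀ L))
      (Adjacent-concat-applyUpTo N _ (<2^L⇒<N (2a<2^L b<h)) (adjacent-col a<h b<h)))

N²≤16*size*ℓ² : ∀ {h S} ℓ → h * h ≤ S → 2 * (2 * h) * (2 * (2 * h)) ≤ 16 * (S * (suc ℓ * suc ℓ))
N²≤16*size*ℓ² {h} {S} ℓ h²≤S =
  ≤-trans (≤-reflexive (identity h)) (*-monoʳ-≤ 16 (≤-trans h²≤S (m≤m*n S (suc ℓ * suc ℓ))))
  where
  identity : ∀ h → 2 * (2 * h) * (2 * (2 * h)) ≡ 16 * (h * h)
  identity = solve-∀

2+n≤16*[1+n] : ∀ n → 2 + n ≤ 16 * suc n
2+n≤16*[1+n] n = subst (2 + n ≤_) (identity n) (m≤m+n _ (15 * n + 14))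
  where
  identity : ∀ n → 2 + n + (15 * n + 14) ≡ 16 * suc n
  identity = solve-∀

3ℓ≤16ℓ : ∀ ℓ → ℓ + ℓ + ℓ ≤ 16 * ℓ
3ℓ≤16ℓ ℓ = subst (ℓ + ℓ + ℓ ≤_) (identity ℓ) (m≤m+n _ (13 * ℓ))
  where
  identity : ∀ ℓ → ℓ + ℓ + ℓ + 13 * ℓ ≡ 16 * ℓ
  identity = solve-∀

N*3ℓ+N*3ℓ≤16Nℓ : ∀ N ℓ → N * (ℓ + ℓ + ℓ) + N * (ℓ + ℓ + ℓ) ≤ 16 * (N * ℓ)
N*3ℓ+N*3ℓ≤16Nℓ N ℓ = subst (N * (ℓ + ℓ + ℓ) + N * (ℓ + ℓ + ℓ) ≤_) (identity N ℓ) (m≤m+n _ (10 * (N * ℓ)))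
  where
  identity : ∀ N ℓ → N * (ℓ + ℓ + ℓ) + N * (ℓ + ℓ + ℓ) + 10 * (N * ℓ) ≡ 16 * (N * ℓ)
  identity = solve-∀

-- Stated for any ℓ equal to 2 + m, so that ⌊log₂ N⌋ can be put in for ℓ.
module _ (m : ℕ) {ℓ : ℕ} where

  row-rle≤ : 2 + m ≡ ℓ → ∀ i → Σ (RLE ℕ (row (Amat (suc m)) i)) λ r → rleSize r ≤ 16 * ℓ
  row-rle≤ refl i = map₂ (λ r≤ → ≤-trans r≤ (2+n≤16*[1+n] (suc m))) (row-Amat-rle (suc m) i)

  col-rle≤ : 2 + m ≡ ℓ → ∀ j → Σ (RLE ℕ (col (Bmat (suc m)) j)) λ r → rleSize r ≤ 16 * ℓ
  col-rle≤ refl j = map₂ (λ r≤ → ≤-trans r≤ (2+n≤16*[1+n] (suc m))) (col-Bmat-rle (suc m) j)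

  row-gc≤ : 2 + m ≡ ℓ → ∀ i → Compressible (row (Amat (suc m)) i) (16 * ℓ)
  row-gc≤ refl i = compressible-≤ (3ℓ≤16ℓ (2 + m)) (row-Amat-compressible (suc m) i)

  col-gc≤ : 2 + m ≡ ℓ → ∀ j → Compressible (col (Bmat (suc m)) j) (16 * ℓ)
  col-gc≤ refl j = compressible-≤ (3ℓ≤16ℓ (2 + m)) (col-Bmat-compressible (suc m) j)

  convenient≤ : 2 + m ≡ ℓ →
                Σ (ConvenientCompression (Amat (suc m)) (Bmat (suc m))) λ g → convSize g ≤ 16 * (2 ^ (2 + m) * ℓ)
  convenient≤ refl = record { rowsA = proj₁ ∘ row-Amat-compressible (suc m) ; colsB = proj₁ ∘ col-Bmat-compressible (suc m) } ,
    ≤-trans (+-mono-≤ (sumFin-≤ _ (proj₂ ∘ row-Amat-compressible (suc m)))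
                      (sumFin-≤ _ (proj₂ ∘ col-Bmat-compressible (suc m))))
            (N*3ℓ+N*3ℓ≤16Nℓ (2 ^ (2 + m)) (2 + m))

  strong-A≤ : 2 + m ≡ ℓ → Σ (StrongCompression (Amat (suc m))) λ g → strongSize (Amat (suc m)) g ≤ 16 * (ℓ * ℓ)
  strong-A≤ refl = Product.map inj₂ (λ g≤ → ≤-trans g≤ (strongCost≤ (suc m))) (flatten-Aᵀ-compressible (suc m))

  strong-B≤ : 2 + m ≡ ℓ → Σ (StrongCompression (Bmat (suc m))) λ g → strongSize (Bmat (suc m)) g ≤ 16 * (ℓ * ℓ)
  strong-B≤ refl = Product.map inj₁ (λ g≤ → ≤-trans g≤ (strongCost≤ (suc m))) (flatten-B-compressible (suc m))

  rowWise≥ : 2 + m ≡ ℓ → (g : RowWiseCompression (Amat (suc m) ⊗ Bmat (suc m))) →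
             2 ^ (2 + m) * 2 ^ (2 + m) ≤ 16 * (rowWiseSize (Amat (suc m) ⊗ Bmat (suc m)) g * (ℓ * ℓ))
  rowWise≥ refl g = N²≤16*size*ℓ² {h = 2 ^ m} (suc m) (ProductLowerBounds.rowWise-size m g)

  colWise≥ : 2 + m ≡ ℓ → (g : ColumnWiseCompression (Amat (suc m) ⊗ Bmat (suc m))) →
             2 ^ (2 + m) * 2 ^ (2 + m) ≤ 16 * (columnWiseSize (Amat (suc m) ⊗ Bmat (suc m)) g * (ℓ * ℓ))
  colWise≥ refl g = N²≤16*size*ℓ² {h = 2 ^ m} (suc m) (ProductLowerBounds.colWise-size m g)

  strong≥ : 2 + m ≡ ℓ → (g : StrongCompression (Amat (suc m) ⊗ Bmat (suc m))) →
            2 ^ (2 + m) * 2 ^ (2 + m) ≤ 16 * (strongSize (Amat (suc m) ⊗ Bmat (suc m)) g * (ℓ * ℓ))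
  strong≥ refl g = N²≤16*size*ℓ² {h = 2 ^ m} (suc m) (ProductLowerBounds.strong-size m g)

theorem3 : ∃ λ (c : ℕ) → (m : ℕ) → ∃ λ (N : ℕ) → m ≤ N × Σ (Matrix N) λ A → Σ (Matrix N) λ B →
    IsZeroOne A × IsZeroOne B
    -- (1) run-length encodings / grammar compressions of size O(log N), convenient compression O(N log N)
    × ((i : Fin N) → Σ (RLE ℕ (row A i)) λ r → rleSize r ≤ c * ⌊log₂ N ⌋)
    × ((j : Fin N) → Σ (RLE ℕ (col B j)) λ r → rleSize r ≤ c * ⌊log₂ N ⌋)
    × ((i : Fin N) → Σ (GrammarCompression ℕ (row A i)) λ g → gcSize g ≤ c * ⌊log₂ N ⌋)
    × ((j : Fin N) → Σ (GrammarCompression ℕ (col B j)) λ g → gcSize g ≤ c * ⌊log₂ N ⌋)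
    × Σ (ConvenientCompression A B) (λ g → convSize g ≤ c * (N * ⌊log₂ N ⌋))
    -- (2) strong compressions of size O(log² N)
    × Σ (StrongCompression A) (λ g → strongSize A g ≤ c * (⌊log₂ N ⌋ * ⌊log₂ N ⌋))
    × Σ (StrongCompression B) (λ g → strongSize B g ≤ c * (⌊log₂ N ⌋ * ⌊log₂ N ⌋))
    -- (3) every compression of C = A B has size Ω(N² / log² N)
    × ((g : RowWiseCompression (A ⊗ B)) → N * N ≤ c * (rowWiseSize (A ⊗ B) g * (⌊log₂ N ⌋ * ⌊log₂ N ⌋)))
    × ((g : ColumnWiseCompression (A ⊗ B)) → N * N ≤ c * (columnWiseSize (A ⊗ B) g * (⌊log₂ N ⌋ * ⌊log₂ N ⌋)))
    × ((g : StrongCompression (A ⊗ B)) → N * N ≤ c * (strongSize (A ⊗ B) g * (⌊log₂ N ⌋ * ⌊log₂ N ⌋)))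
theorem3 = 16 , λ m → let ℓ≡ = sym (⌊log₂[2^n]⌋≡n (2 + m)) in
  2 ^ (2 + m) , <⇒≤ (≤-trans (n<2^n m) (^-monoʳ-≤ 2 (m≤n+m m 2))) , Amat (suc m) , Bmat (suc m) ,
  Amat-zero-one (suc m) , Bmat-zero-one (suc m) ,
  row-rle≤ m ℓ≡ , col-rle≤ m ℓ≡ , row-gc≤ m ℓ≡ , col-gc≤ m ℓ≡ , convenient≤ m ℓ≡ ,
  strong-A≤ m ℓ≡ , strong-B≤ m ℓ≡ ,
  rowWise≥ m ℓ≡ , colWise≥ m ℓ≡ , strong≥ m ℓ≡
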